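{- For each integer $m\ge0$, with $F_m(s)=\sum_{j=0}^m\frac{a_{m,j}B_j}{s+j-1}$, \[ F_m(s)=\frac{m!\,\det\big(L_m+(1-s)U_m\big)}{(s-1)s(s+1)\cdots(s+m-1)}, \] where $L_m$ is the $(m+1)\times(m+1)$ lower triangular Toeplitz matrix with entries $(L_m)_{ik}=\frac{1}{i-k+1}$ for $i\ge k$ and $0$ for $i<k$ (indices $0\le i,k\le m$), and $U_m$ is the $(m+1)\times(m+1)$ matrix with entries $(U_m)_{ik}=\frac1k$ for $k>i$ and $0$ for $k\le i$.
   Context: For an integer $m\ge0$, $p_m(t)=(1-t)(1-t/2)\cdots(1-t/m)$ (with $p_0\equiv1$), and the coefficients $a_{m,j}$ are defined by $p_m(t)=\sum_{j=0}^m(-1)^j a_{m,j}t^j$. The $B_j$ are the Bernoulli numbers defined by $\frac{z}{e^z-1}=\sum_{j\ge0}\frac{B_j}{j!}z^j$. Thus $L_m$ has first column $(1,1/2,\dots,1/(m+1))^T$ and $U_m$ has rows $(0,1,1/2,\dots,1/m)$, $(0,0,1/2,\dots,1/m)$, ..., $(0,\dots,0)$. -}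

module Defs where

open import Data.Nat as ℕ using (ℕ; zero; suc; _≤?_; _<?_)
open import Data.Nat.Combinatorics using () 
open import Data.Integer using (+_)
open import Data.Fin using (Fin; toℕ; punchIn) renaming (zero to fzero; suc to fsuc)
open import Data.Rational using (ℚ; 0ℚ; 1ℚ; _+_; _*_; _-_; -_; 1/_; _/_; _≟_; ≢-nonZero)
open import Data.List using (List; []; _∷_)
open import Relation.Nullary using (yes; no)

ι : ℕ → ℚ
ι n = (+ n) / 1

fact : ℕ → ℚ
fact zero = 1ℚ
fact (suc n) = ι (suc n) * fact n

-- total reciprocal (value at 0 is irrelevant: only used where the argument is nonzero)
inv : ℚ → ℚ
inv p with p ≟ 0ℚ
... | yes _ = 0ℚ
... | no p≢0 = 1/_ p {{≢-nonZero p≢0}}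

sumTo : ℕ → (ℕ → ℚ) → ℚ
sumTo zero f = 0ℚ
sumTo (suc n) f = sumTo n f + f n

prodTo : ℕ → (ℕ → ℚ) → ℚ
prodTo zero f = 1ℚ
prodTo (suc n) f = prodTo n f * f n

sumFin : (n : ℕ) → (Fin n → ℚ) → ℚ
sumFin zero f = 0ℚ
sumFin (suc n) f = f fzero + sumFin n (λ i → f (fsuc i))

sign : ℕ → ℚ
sign zero = 1ℚ
sign (suc n) = - sign n

-- coefficient of t^j in p_m(t) = (1 - t)(1 - t/2)...(1 - t/m)
-- p_{m+1}(t) = p_m(t) * (1 - t/(m+1))
pcoeff : ℕ → ℕ → ℚ
pcoeff zero zero = 1ℚ
pcoeff zero (suc j) = 0ℚ
pcoeff (suc m) zero = pcoeff m zero
pcoeff (suc m) (suc j) = pcoeff m (suc j) - pcoeff m j * ((+ 1) / suc m)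

-- p_m(t) = Σ_j (-1)^j a_{m,j} t^j
a : ℕ → ℕ → ℚ
a m j = sign j * pcoeff m j

-- Coefficients c_n = B_n / n! of z/(e^z - 1), the multiplicative inverse of the
-- power series (e^z - 1)/z = Σ_k z^k/(k+1)!:
--   c_0 = 1,  c_n = - Σ_{k=1}^{n} c_{n-k} / (k+1)!.
-- bernTable n = [c_n, c_{n-1}, ..., c_0]
private
  step : ℕ → List ℚ → ℚ
  step i [] = 0ℚ
  step i (c ∷ cs) = c * inv (fact (i ℕ.+ 2)) + step (suc i) cs

bernTable : ℕ → List ℚ
bernTable zero = 1ℚ ∷ []
bernTable (suc n) = (- step 0 (bernTable n)) ∷ bernTable n

headQ : List ℚ → ℚ
headQ [] = 0ℚ
headQ (x ∷ _) = x

-- Bernoulli numbers, z/(e^z-1) = Σ B_j z^j / j!  (so B_1 = -1/2)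
B : ℕ → ℚ
B n = fact n * headQ (bernTable n)

det : (n : ℕ) → (Fin n → Fin n → ℚ) → ℚ
det zero A = 1ℚ
det (suc n) A = sumFin (suc n) (λ k →
  sign (toℕ k) * A fzero k * det n (λ i j → A (fsuc i) (punchIn k j)))

L : (m : ℕ) → Fin (suc m) → Fin (suc m) → ℚ
L m i k with toℕ k ≤? toℕ i
... | yes _ = (+ 1) / suc (toℕ i ℕ.∸ toℕ k)
... | no _ = 0ℚ

U : (m : ℕ) → Fin (suc m) → Fin (suc m) → ℚ
U m i k with toℕ i <? toℕ k
... | yes _ = inv (ι (toℕ k))
... | no _ = 0ℚ

F : ℕ → ℚ → ℚ
F m s = sumTo (suc m) (λ j → a m j * B j * inv (s + ι j - 1ℚ))

{-# OPTIONS --safe #-}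
-- Let M = L_m + (1 - s) U_m and subtract from every row of M the row above it.  Below its first
-- row the resulting matrix is lower triangular with diagonal entries (s + r)/(r + 1), so these
-- rows have a one-dimensional kernel; if u spans it with u₀ = 1, the first-row cofactors are
-- proportional to u and det M = Π_{r<m} (s + r)/(r + 1) · Σ_k M_{0k} u_k.  Such a u is u₀ = 1,
-- u_{k+1} = -Σ_{i≤k} a_{k,i} B_{i+1}/(s + i): every row of M pairs with it to (s - 1) F_m(s).
-- This rests on F_{r+1} = F_r - u_{r+1}/(r + 1) and on two identities for the a_{r,j}, namely
-- Σ_{k<r} a_{k,i}/(r - k) = (i + 1) a_{r,i+1} and Σ_j a_{r,j} B_j = 1/(r + 1); the latter is the
-- umbral rule f(B + 1) = f(B) + f′(0) applied to p_{r+1}(-t).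
module Submission where

open import Defs
open import Data.Nat using (ℕ; zero; suc; _∸_; _≤_; _<_; z≤n; s≤s)
import Data.Nat as ℕ
import Data.Nat.Properties as ℕₚ
open import Data.Nat.Coprimality using (1-coprimeTo) renaming (sym to coprime-sym)
import Data.Integer as ℤ
import Data.Integer.Properties as ℤₚ
open import Data.Fin using (Fin; toℕ; punchIn; punchOut; inject₁) renaming (zero to fzero; suc to fsuc)
import Data.Fin.Properties as Finₚ
open import Data.Rational using (ℚ; mkℚ; 0ℚ; 1ℚ; _+_; _*_; _-_; -_; _/_; _≟_; ≢-nonZero)
import Data.Rational.Properties as ℚₚ
open import Algebra.Properties.Group ℚₚ.+-0-group using (x∙y⁻¹≈ε⇒x≈y; ∙-cancelʳ)
open import Data.Vec.Functional using (_∷_)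
open import Data.List using (List)
open import Data.Empty using (⊥-elim)
open import Function using (_∘_; case_of_)
open import Relation.Nullary using (yes; no)
open import Relation.Binary.Definitions using (tri<; tri≈; tri>)
open import Relation.Nullary.Decidable using (dec⇒maybe)
open import Relation.Binary.PropositionalEquality
open import Tactic.RingSolver using (solve-∀)
open import Tactic.RingSolver.Core.AlmostCommutativeRing using (AlmostCommutativeRing; fromCommutativeRing)
open ≡-Reasoning

ℚ-ring : AlmostCommutativeRing _ _
ℚ-ring = fromCommutativeRing ℚₚ.+-*-commutativeRing (λ x → dec⇒maybe (0ℚ ≟ x))

ι≡mkℚ : ∀ n → ι n ≡ mkℚ (ℤ.+ n) 0 (coprime-sym (1-coprimeTo n))
ι≡mkℚ n = ℚₚ.↥p/↧p≡p _

ι-suc : ∀ n → ι (suc n) ≡ 1ℚ + ι n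
ι-suc n = begin
  (ℤ.+ suc n) / 1                                        ≡⟨ ℚₚ./-cong (cong (λ z → ℤ.+ 1 ℤ.+ z) (sym (ℤₚ.*-identityʳ (ℤ.+ n)))) refl ⟩
  ((ℤ.+ 1 ℤ.* ℤ.+ 1) ℤ.+ (ℤ.+ n ℤ.* ℤ.+ 1)) / (1 ℕ.* 1) ≡⟨ cong (1ℚ +_) (ι≡mkℚ n) ⟨
  1ℚ + ι n                                               ∎

ι-+ : ∀ m n → ι (m ℕ.+ n) ≡ ι m + ι n
ι-+ zero    n = sym (ℚₚ.+-identityˡ (ι n))
ι-+ (suc m) n = begin
  ι (suc (m ℕ.+ n))  ≡⟨ ι-suc (m ℕ.+ n) ⟩
  1ℚ + ι (m ℕ.+ n)   ≡⟨ cong (1ℚ +_) (ι-+ m n) ⟩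
  1ℚ + (ι m + ι n)   ≡⟨ ℚₚ.+-assoc 1ℚ (ι m) (ι n) ⟨
  1ℚ + ι m + ι n     ≡⟨ cong (_+ ι n) (ι-suc m) ⟨
  ι (suc m) + ι n    ∎

ι-suc≢0 : ∀ n → ι (suc n) ≢ 0ℚ
ι-suc≢0 n eq with trans (sym (ι≡mkℚ (suc n))) eq
... | ()

inv-inverseʳ : ∀ {p} → p ≢ 0ℚ → p * inv p ≡ 1ℚ
inv-inverseʳ {p} p≢0 with p ≟ 0ℚ
... | yes p≡0 = ⊥-elim (p≢0 p≡0)
... | no  p≢0 = ℚₚ.*-inverseʳ p {{≢-nonZero p≢0}}

inv-inverseˡ : ∀ {p} → p ≢ 0ℚ → inv p * p ≡ 1ℚ
inv-inverseˡ {p} p≢0 = trans (ℚₚ.*-comm (inv p) p) (inv-inverseʳ p≢0)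

*-cancelˡ-≡0 : ∀ {p q} → p ≢ 0ℚ → p * q ≡ 0ℚ → q ≡ 0ℚ
*-cancelˡ-≡0 {p} {q} p≢0 pq≡0 = begin
  q               ≡⟨ ℚₚ.*-identityˡ q ⟨
  1ℚ * q          ≡⟨ cong (_* q) (inv-inverseˡ p≢0) ⟨
  inv p * p * q   ≡⟨ ℚₚ.*-assoc (inv p) p q ⟩
  inv p * (p * q) ≡⟨ cong (inv p *_) pq≡0 ⟩
  inv p * 0ℚ      ≡⟨ ℚₚ.*-zeroʳ (inv p) ⟩
  0ℚ              ∎

*≢0 : ∀ {p q} → p ≢ 0ℚ → q ≢ 0ℚ → p * q ≢ 0ℚ
*≢0 p≢0 q≢0 = q≢0 ∘ *-cancelˡ-≡0 p≢0

inv-*-distrib : ∀ {p q} → p ≢ 0ℚ → q ≢ 0ℚ → inv (p * q) ≡ inv p * inv q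
inv-*-distrib {p} {q} p≢0 q≢0 = begin
  inv (p * q)                                     ≡⟨ ℚₚ.*-identityʳ (inv (p * q)) ⟨
  inv (p * q) * 1ℚ                                ≡⟨ cong (inv (p * q) *_) (cong₂ _*_ (inv-inverseʳ p≢0) (inv-inverseʳ q≢0)) ⟨
  inv (p * q) * (p * inv p * (q * inv q))         ≡⟨ regroup (inv (p * q)) p q (inv p) (inv q) ⟩
  inv (p * q) * (p * q) * (inv p * inv q)         ≡⟨ cong (_* (inv p * inv q)) (inv-inverseˡ (*≢0 p≢0 q≢0)) ⟩
  1ℚ * (inv p * inv q)                            ≡⟨ ℚₚ.*-identityˡ (inv p * inv q) ⟩
  inv p * inv q                                   ∎
  where
  regroup : ∀ i p q a b → i * (p * a * (q * b)) ≡ i * (p * q) * (a * b)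
  regroup = solve-∀ ℚ-ring

*-distribˡ-- : ∀ c a b → c * (a - b) ≡ c * a - c * b
*-distribˡ-- = solve-∀ ℚ-ring

*-inv-cancel : ∀ {p q} y → p ≢ 0ℚ → q ≢ 0ℚ → q * (p * y) * inv (p * q) ≡ y
*-inv-cancel {p} {q} y p≢0 q≢0 = begin
  q * (p * y) * inv (p * q)           ≡⟨ cong (q * (p * y) *_) (inv-*-distrib p≢0 q≢0) ⟩
  q * (p * y) * (inv p * inv q)       ≡⟨ regroup q p y (inv p) (inv q) ⟩
  p * inv p * (q * inv q) * y         ≡⟨ cong₂ (λ a b → a * b * y) (inv-inverseʳ p≢0) (inv-inverseʳ q≢0) ⟩
  1ℚ * 1ℚ * y                         ≡⟨ ℚₚ.*-identityˡ y ⟩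
  y                                   ∎
  where
  regroup : ∀ q p y a b → q * (p * y) * (a * b) ≡ p * a * (q * b) * y
  regroup = solve-∀ ℚ-ring

fact≢0 : ∀ n → fact n ≢ 0ℚ
fact≢0 zero    ()
fact≢0 (suc n) = *≢0 (ι-suc≢0 n) (fact≢0 n)

ι⁻¹ : ℕ → ℚ
ι⁻¹ n = inv (ι n)

ι⁻¹-suc≡1/suc : ∀ n → ι⁻¹ (suc n) ≡ ℤ.+ 1 / suc n
ι⁻¹-suc≡1/suc n = trans (cong inv (ι≡mkℚ (suc n))) (sym (ℚₚ.↥p/↧p≡p _))

ι⁻¹-inverseˡ : ∀ n → ι⁻¹ (suc n) * ι (suc n) ≡ 1ℚ
ι⁻¹-inverseˡ n = inv-inverseˡ (ι-suc≢0 n)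

sumTo-cong : ∀ n {f g : ℕ → ℚ} → (∀ k → k < n → f k ≡ g k) → sumTo n f ≡ sumTo n g
sumTo-cong zero    f≗g = refl
sumTo-cong (suc n) f≗g = cong₂ _+_ (sumTo-cong n (λ k k<n → f≗g k (ℕₚ.m<n⇒m<1+n k<n))) (f≗g n ℕₚ.≤-refl)

sumTo-zero : ∀ n {f : ℕ → ℚ} → (∀ k → k < n → f k ≡ 0ℚ) → sumTo n f ≡ 0ℚ
sumTo-zero zero    f≡0 = refl
sumTo-zero (suc n) f≡0 = cong₂ _+_ (sumTo-zero n (λ k k<n → f≡0 k (ℕₚ.m<n⇒m<1+n k<n))) (f≡0 n ℕₚ.≤-refl)

sumTo-+ : ∀ n (f g : ℕ → ℚ) → sumTo n (λ k → f k + g k) ≡ sumTo n f + sumTo n g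
sumTo-+ zero    f g = refl
sumTo-+ (suc n) f g = trans (cong (_+ (f n + g n)) (sumTo-+ n f g)) (interchange (sumTo n f) (sumTo n g) (f n) (g n))
  where
  interchange : ∀ a b c d → a + b + (c + d) ≡ a + c + (b + d)
  interchange = solve-∀ ℚ-ring

sumTo-neg : ∀ n (f : ℕ → ℚ) → sumTo n (λ k → - f k) ≡ - sumTo n f
sumTo-neg zero    f = refl
sumTo-neg (suc n) f = trans (cong (_+ - f n) (sumTo-neg n f)) (sym (ℚₚ.neg-distrib-+ (sumTo n f) (f n)))

sumTo-- : ∀ n (f g : ℕ → ℚ) → sumTo n (λ k → f k - g k) ≡ sumTo n f - sumTo n g
sumTo-- n f g = trans (sumTo-+ n f (λ k → - g k)) (cong (sumTo n f +_) (sumTo-neg n g))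

sumTo-*ˡ : ∀ n c (f : ℕ → ℚ) → sumTo n (λ k → c * f k) ≡ c * sumTo n f
sumTo-*ˡ zero    c f = sym (ℚₚ.*-zeroʳ c)
sumTo-*ˡ (suc n) c f = trans (cong (_+ c * f n) (sumTo-*ˡ n c f)) (sym (ℚₚ.*-distribˡ-+ c (sumTo n f) (f n)))

sumTo-*ʳ : ∀ n c (f : ℕ → ℚ) → sumTo n (λ k → f k * c) ≡ sumTo n f * c
sumTo-*ʳ n c f = begin
  sumTo n (λ k → f k * c) ≡⟨ sumTo-cong n (λ k _ → ℚₚ.*-comm (f k) c) ⟩
  sumTo n (λ k → c * f k) ≡⟨ sumTo-*ˡ n c f ⟩
  c * sumTo n f           ≡⟨ ℚₚ.*-comm c (sumTo n f) ⟩
  sumTo n f * c           ∎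

sumTo-sucˡ : ∀ n (f : ℕ → ℚ) → sumTo (suc n) f ≡ f 0 + sumTo n (f ∘ suc)
sumTo-sucˡ zero    f = trans (ℚₚ.+-identityˡ (f 0)) (sym (ℚₚ.+-identityʳ (f 0)))
sumTo-sucˡ (suc n) f = trans (cong (_+ f (suc n)) (sumTo-sucˡ n f)) (ℚₚ.+-assoc (f 0) _ _)

sumTo-comm : ∀ n p (f : ℕ → ℕ → ℚ) →
             sumTo n (λ i → sumTo p (f i)) ≡ sumTo p (λ j → sumTo n (λ i → f i j))
sumTo-comm zero    p f = sym (sumTo-zero p (λ _ _ → refl))
sumTo-comm (suc n) p f = begin
  sumTo n (λ i → sumTo p (f i)) + sumTo p (f n)         ≡⟨ cong (_+ sumTo p (f n)) (sumTo-comm n p f) ⟩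
  sumTo p (λ j → sumTo n (λ i → f i j)) + sumTo p (f n) ≡⟨ sumTo-+ p _ _ ⟨
  sumTo p (λ j → sumTo n (λ i → f i j) + f n j)         ∎

sumTo-reverse : ∀ n (f : ℕ → ℚ) → sumTo (suc n) (λ l → f (n ∸ l)) ≡ sumTo (suc n) f
sumTo-reverse zero    f = refl
sumTo-reverse (suc n) f = begin
  sumTo (suc (suc n)) (λ l → f (suc n ∸ l))     ≡⟨ sumTo-sucˡ (suc n) _ ⟩
  f (suc n) + sumTo (suc n) (λ l → f (n ∸ l))   ≡⟨ cong (f (suc n) +_) (sumTo-reverse n f) ⟩
  f (suc n) + sumTo (suc n) f                   ≡⟨ ℚₚ.+-comm (f (suc n)) (sumTo (suc n) f) ⟩
  sumTo (suc (suc n)) f                         ∎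

sumTo-extend : ∀ n N (f : ℕ → ℚ) → n ≤ N → (∀ k → n ≤ k → f k ≡ 0ℚ) → sumTo N f ≡ sumTo n f
sumTo-extend n N f n≤N f≡0 = begin
  sumTo N f               ≡⟨ cong (λ M → sumTo M f) (ℕₚ.m+[n∸m]≡n n≤N) ⟨
  sumTo (n ℕ.+ (N ∸ n)) f ≡⟨ pad (N ∸ n) ⟩
  sumTo n f               ∎
  where
  pad : ∀ p → sumTo (n ℕ.+ p) f ≡ sumTo n f
  pad zero    = cong (λ M → sumTo M f) (ℕₚ.+-identityʳ n)
  pad (suc p) = begin
    sumTo (n ℕ.+ suc p) f           ≡⟨ cong (λ M → sumTo M f) (ℕₚ.+-suc n p) ⟩
    sumTo (n ℕ.+ p) f + f (n ℕ.+ p) ≡⟨ cong₂ _+_ (pad p) (f≡0 (n ℕ.+ p) (ℕₚ.m≤m+n n p)) ⟩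
    sumTo n f + 0ℚ                  ≡⟨ ℚₚ.+-identityʳ _ ⟩
    sumTo n f                       ∎

sumFin-cong : ∀ n {f g : Fin n → ℚ} → (∀ k → f k ≡ g k) → sumFin n f ≡ sumFin n g
sumFin-cong zero    f≗g = refl
sumFin-cong (suc n) f≗g = cong₂ _+_ (f≗g fzero) (sumFin-cong n (f≗g ∘ fsuc))

sumFin-zero : ∀ n {f : Fin n → ℚ} → (∀ k → f k ≡ 0ℚ) → sumFin n f ≡ 0ℚ
sumFin-zero zero    f≡0 = refl
sumFin-zero (suc n) f≡0 = cong₂ _+_ (f≡0 fzero) (sumFin-zero n (f≡0 ∘ fsuc))

sumFin≡sumTo : ∀ n (f : Fin n → ℚ) (g : ℕ → ℚ) → (∀ k → f k ≡ g (toℕ k)) → sumFin n f ≡ sumTo n g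
sumFin≡sumTo zero    f g f≗g = refl
sumFin≡sumTo (suc n) f g f≗g = begin
  f fzero + sumFin n (f ∘ fsuc) ≡⟨ cong₂ _+_ (f≗g fzero) (sumFin≡sumTo n (f ∘ fsuc) (g ∘ suc) (f≗g ∘ fsuc)) ⟩
  g 0 + sumTo n (g ∘ suc)       ≡⟨ sumTo-sucˡ n g ⟨
  sumTo (suc n) g               ∎

sumFin-+ : ∀ n (f g : Fin n → ℚ) → sumFin n (λ k → f k + g k) ≡ sumFin n f + sumFin n g
sumFin-+ zero    f g = refl
sumFin-+ (suc n) f g = trans (cong (f fzero + g fzero +_) (sumFin-+ n (f ∘ fsuc) (g ∘ fsuc)))
                             (interchange (f fzero) (g fzero) _ _)
  where
  interchange : ∀ a b c d → a + b + (c + d) ≡ a + c + (b + d)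
  interchange = solve-∀ ℚ-ring

sumFin-neg : ∀ n (f : Fin n → ℚ) → sumFin n (λ k → - f k) ≡ - sumFin n f
sumFin-neg zero    f = refl
sumFin-neg (suc n) f = trans (cong (- f fzero +_) (sumFin-neg n (f ∘ fsuc))) (sym (ℚₚ.neg-distrib-+ (f fzero) _))

sumFin-- : ∀ n (f g : Fin n → ℚ) → sumFin n (λ k → f k - g k) ≡ sumFin n f - sumFin n g
sumFin-- n f g = trans (sumFin-+ n f (λ k → - g k)) (cong (sumFin n f +_) (sumFin-neg n g))

sumFin-*ˡ : ∀ n c (f : Fin n → ℚ) → sumFin n (λ k → c * f k) ≡ c * sumFin n f
sumFin-*ˡ zero    c f = sym (ℚₚ.*-zeroʳ c)
sumFin-*ˡ (suc n) c f = trans (cong (c * f fzero +_) (sumFin-*ˡ n c (f ∘ fsuc))) (sym (ℚₚ.*-distribˡ-+ c _ _))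

sumFin-comm : ∀ n p (f : Fin n → Fin p → ℚ) →
              sumFin n (λ i → sumFin p (f i)) ≡ sumFin p (λ j → sumFin n (λ i → f i j))
sumFin-comm zero    p f = sym (sumFin-zero p (λ _ → refl))
sumFin-comm (suc n) p f = begin
  sumFin p (f fzero) + sumFin n (λ i → sumFin p (f (fsuc i)))         ≡⟨ cong (sumFin p (f fzero) +_) (sumFin-comm n p (f ∘ fsuc)) ⟩
  sumFin p (f fzero) + sumFin p (λ j → sumFin n (λ i → f (fsuc i) j)) ≡⟨ sumFin-+ p _ _ ⟨
  sumFin p (λ j → f fzero j + sumFin n (λ i → f (fsuc i) j))          ∎

sumFin-punchIn : ∀ n (k : Fin (suc n)) (f : Fin (suc n) → ℚ) → sumFin (suc n) f ≡ f k + sumFin n (f ∘ punchIn k)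
sumFin-punchIn n       fzero    f = refl
sumFin-punchIn (suc n) (fsuc k) f = begin
  f fzero + sumFin (suc n) (f ∘ fsuc)                              ≡⟨ cong (f fzero +_) (sumFin-punchIn n k (f ∘ fsuc)) ⟩
  f fzero + (f (fsuc k) + sumFin n (f ∘ fsuc ∘ punchIn k))         ≡⟨ exchange (f fzero) (f (fsuc k)) _ ⟩
  f (fsuc k) + (f fzero + sumFin n (f ∘ fsuc ∘ punchIn k))         ∎
  where
  exchange : ∀ a b c → a + (b + c) ≡ b + (a + c)
  exchange = solve-∀ ℚ-ring

sumFin-single : ∀ n (r : Fin n) (f : Fin n → ℚ) → (∀ k → k ≢ r → f k ≡ 0ℚ) → sumFin n f ≡ f r
sumFin-single (suc n) r f f≡0 = begin
  sumFin (suc n) f                 ≡⟨ sumFin-punchIn n r f ⟩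
  f r + sumFin n (f ∘ punchIn r)   ≡⟨ cong (f r +_) (sumFin-zero n (λ l → f≡0 (punchIn r l) (Finₚ.punchInᵢ≢i r l))) ⟩
  f r + 0ℚ                         ≡⟨ ℚₚ.+-identityʳ (f r) ⟩
  f r                              ∎

prodTo-sucˡ : ∀ n (g : ℕ → ℚ) → prodTo (suc n) g ≡ g 0 * prodTo n (g ∘ suc)
prodTo-sucˡ zero    g = trans (ℚₚ.*-identityˡ (g 0)) (sym (ℚₚ.*-identityʳ (g 0)))
prodTo-sucˡ (suc n) g = trans (cong (_* g (suc n)) (prodTo-sucˡ n g)) (ℚₚ.*-assoc (g 0) _ _)

prodTo≢0 : ∀ n (g : ℕ → ℚ) → (∀ j → j < n → g j ≢ 0ℚ) → prodTo n g ≢ 0ℚ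
prodTo≢0 zero    g g≢0 ()
prodTo≢0 (suc n) g g≢0 = *≢0 (prodTo≢0 n g (λ j j<n → g≢0 j (ℕₚ.m<n⇒m<1+n j<n))) (g≢0 n ℕₚ.≤-refl)

Mat : ℕ → Set
Mat n = Fin n → Fin n → ℚ

sgn : ∀ {n} → Fin n → ℚ
sgn k = sign (toℕ k)

det-cong : ∀ n {A B : Mat n} → (∀ i j → A i j ≡ B i j) → det n A ≡ det n B
det-cong zero    A≗B = refl
det-cong (suc n) A≗B = sumFin-cong (suc n) (λ k →
  cong₂ (λ a d → sgn k * a * d) (A≗B fzero k) (det-cong n (λ i j → A≗B (fsuc i) (punchIn k j))))

sumFin-punchIn₂ : ∀ n (f : Fin (suc n) → Fin (suc n) → ℚ) → (∀ a → f a a ≡ 0ℚ) →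
                  sumFin (suc n) (λ k → sumFin n (λ l → f k (punchIn k l))) ≡ sumFin (suc n) (λ a → sumFin (suc n) (f a))
sumFin-punchIn₂ n f f-diag = sumFin-cong (suc n) (λ a → begin
  sumFin n (f a ∘ punchIn a)         ≡⟨ ℚₚ.+-identityˡ _ ⟨
  0ℚ + sumFin n (f a ∘ punchIn a)    ≡⟨ cong (_+ sumFin n (f a ∘ punchIn a)) (f-diag a) ⟨
  f a a + sumFin n (f a ∘ punchIn a) ≡⟨ sumFin-punchIn n a (f a) ⟨
  sumFin (suc n) (f a)               ∎)

punchIn-punchIn-punchOut : ∀ {n} (k : Fin (suc (suc n))) (l : Fin (suc n)) (p : punchIn k l ≢ k) (j : Fin n) →
                           punchIn (punchIn k l) (punchIn (punchOut p) j) ≡ punchIn k (punchIn l j)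
punchIn-punchIn-punchOut fzero    l        p j = refl
punchIn-punchIn-punchOut (fsuc k) fzero    p j = refl
punchIn-punchIn-punchOut {suc n} (fsuc k) (fsuc l) p fzero    = refl
punchIn-punchIn-punchOut {suc n} (fsuc k) (fsuc l) p (fsuc j) = cong fsuc (punchIn-punchIn-punchOut k l (p ∘ cong fsuc) j)

sgn-punchIn-punchOut : ∀ {n} (k : Fin (suc (suc n))) (l : Fin (suc n)) (p : punchIn k l ≢ k) →
                       sgn (punchIn k l) * sgn (punchOut p) ≡ - (sgn k * sgn l)
sgn-punchIn-punchOut fzero    l     p = negate-left (sgn l)
  where
  negate-left : ∀ s → - s * 1ℚ ≡ - (1ℚ * s)
  negate-left = solve-∀ ℚ-ring
sgn-punchIn-punchOut (fsuc k) fzero p = negate-right (sgn k)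
  where
  negate-right : ∀ s → 1ℚ * s ≡ - (- s * 1ℚ)
  negate-right = solve-∀ ℚ-ring
sgn-punchIn-punchOut {suc n} (fsuc k) (fsuc l) p = begin
  - sgn (punchIn k l) * - sgn (punchOut p′) ≡⟨ neg*neg (sgn (punchIn k l)) (sgn (punchOut p′)) ⟩
  sgn (punchIn k l) * sgn (punchOut p′)     ≡⟨ sgn-punchIn-punchOut k l p′ ⟩
  - (sgn k * sgn l)                         ≡⟨ cong -_ (neg*neg (sgn k) (sgn l)) ⟨
  - (- sgn k * - sgn l)                     ∎
  where
  p′ = p ∘ cong fsuc
  neg*neg : ∀ a b → - a * - b ≡ a * b
  neg*neg = solve-∀ ℚ-ring

minor₂ : ∀ {n} → (Fin n → Fin (suc (suc n)) → ℚ) → Fin (suc (suc n)) → Fin (suc n) → ℚ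
minor₂ R k l = det _ (λ i j → R i (punchIn k (punchIn l j)))

-- The coefficient of A 0 a * A 1 b in det A, where R holds the rows of A below the first two.
pairCofactor : ∀ {n} → (Fin n → Fin (suc (suc n)) → ℚ) → Fin (suc (suc n)) → Fin (suc (suc n)) → ℚ
pairCofactor R a b with a Finₚ.≟ b
... | yes _   = 0ℚ
... | no  a≢b = sgn a * sgn (punchOut a≢b) * minor₂ R a (punchOut a≢b)

module _ {n} (R : Fin n → Fin (suc (suc n)) → ℚ) where

  pairCofactor-diag : ∀ a → pairCofactor R a a ≡ 0ℚ
  pairCofactor-diag a with a Finₚ.≟ a
  ... | yes _   = refl
  ... | no  a≢a = ⊥-elim (a≢a refl)

  pairCofactor-punchIn : ∀ k l → pairCofactor R k (punchIn k l) ≡ sgn k * sgn l * minor₂ R k l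
  pairCofactor-punchIn k l with k Finₚ.≟ punchIn k l
  ... | yes k≡ = ⊥-elim (Finₚ.punchInᵢ≢i k l (sym k≡))
  ... | no  k≢ = cong (λ l′ → sgn k * sgn l′ * minor₂ R k l′) (trans (Finₚ.punchOut-cong k refl) (Finₚ.punchOut-punchIn k))

  pairCofactor-punchIn-flip : ∀ k l → pairCofactor R (punchIn k l) k ≡ - (sgn k * sgn l * minor₂ R k l)
  pairCofactor-punchIn-flip k l with punchIn k l Finₚ.≟ k
  ... | yes eq = ⊥-elim (Finₚ.punchInᵢ≢i k l eq)
  ... | no  p  = begin
    sgn (punchIn k l) * sgn (punchOut p) * minor₂ R (punchIn k l) (punchOut p)
      ≡⟨ cong₂ _*_ (sgn-punchIn-punchOut k l p) (det-cong n (λ i j → cong (R i) (punchIn-punchIn-punchOut k l p j))) ⟩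
    - (sgn k * sgn l) * minor₂ R k l
      ≡⟨ ℚₚ.neg-distribˡ-* (sgn k * sgn l) (minor₂ R k l) ⟨
    - (sgn k * sgn l * minor₂ R k l) ∎

  pairCofactor-antisym : ∀ a b → pairCofactor R b a ≡ - pairCofactor R a b
  pairCofactor-antisym a b = case a Finₚ.≟ b of λ where
    (yes refl) → trans (pairCofactor-diag a) (cong -_ (sym (pairCofactor-diag a)))
    (no a≢b)   → subst (λ b → pairCofactor R b a ≡ - pairCofactor R a b) (Finₚ.punchIn-punchOut a≢b)
                   (trans (pairCofactor-punchIn-flip a (punchOut a≢b)) (cong -_ (sym (pairCofactor-punchIn a (punchOut a≢b)))))

det-pairExpansion : ∀ n (A : Mat (suc (suc n))) →
  det (suc (suc n)) A ≡
  sumFin (suc (suc n)) (λ a → sumFin (suc (suc n)) (λ b → A fzero a * A (fsuc fzero) b * pairCofactor (A ∘ fsuc ∘ fsuc) a b))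
det-pairExpansion n A = begin
  det N A
    ≡⟨ sumFin-cong N (λ k → trans (sym (sumFin-*ˡ (suc n) (sgn k * A fzero k) (row₁-term k))) (sumFin-cong (suc n) (term k))) ⟩
  sumFin N (λ k → sumFin (suc n) (λ l → f k (punchIn k l)))
    ≡⟨ sumFin-punchIn₂ (suc n) f f-diag ⟩
  sumFin N (λ a → sumFin N (f a)) ∎
  where
  N = suc (suc n)
  R = A ∘ fsuc ∘ fsuc
  f : Fin N → Fin N → ℚ
  f a b = A fzero a * A (fsuc fzero) b * pairCofactor R a b
  f-diag : ∀ a → f a a ≡ 0ℚ
  f-diag a = trans (cong (A fzero a * A (fsuc fzero) a *_) (pairCofactor-diag R a)) (ℚₚ.*-zeroʳ (A fzero a * A (fsuc fzero) a))
  row₁-term : Fin N → Fin (suc n) → ℚ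
  row₁-term k l = sgn l * A (fsuc fzero) (punchIn k l) * minor₂ R k l
  rearrange : ∀ s a t b m → s * a * (t * b * m) ≡ a * b * (s * t * m)
  rearrange = solve-∀ ℚ-ring
  term : ∀ k l → sgn k * A fzero k * row₁-term k l ≡ f k (punchIn k l)
  term k l = trans (rearrange (sgn k) (A fzero k) (sgn l) (A (fsuc fzero) (punchIn k l)) (minor₂ R k l))
                   (cong (A fzero k * A (fsuc fzero) (punchIn k l) *_) (sym (pairCofactor-punchIn R k l)))

swap₀₁ : ∀ {n} {X : Set} → (Fin (suc (suc n)) → X) → Fin (suc (suc n)) → X
swap₀₁ A fzero           = A (fsuc fzero)
swap₀₁ A (fsuc fzero)    = A fzero
swap₀₁ A (fsuc (fsuc i)) = A (fsuc (fsuc i))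

det-swap₀₁ : ∀ n (A : Mat (suc (suc n))) → det (suc (suc n)) (swap₀₁ A) ≡ - det (suc (suc n)) A
det-swap₀₁ n A = begin
  det N (swap₀₁ A)                                        ≡⟨ det-pairExpansion n (swap₀₁ A) ⟩
  sumFin N (λ a → sumFin N (λ b → A₁ a * A₀ b * c a b))   ≡⟨ sumFin-comm N N (λ a b → A₁ a * A₀ b * c a b) ⟩
  sumFin N (λ b → sumFin N (λ a → A₁ a * A₀ b * c a b))   ≡⟨ sumFin-cong N (λ b → sumFin-cong N (flip b)) ⟩
  sumFin N (λ b → sumFin N (λ a → - g b a))               ≡⟨ sumFin-cong N (λ b → sumFin-neg N (g b)) ⟩
  sumFin N (λ b → - sumFin N (g b))                       ≡⟨ sumFin-neg N (λ b → sumFin N (g b)) ⟩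
  - sumFin N (λ b → sumFin N (g b))                       ≡⟨ cong -_ (det-pairExpansion n A) ⟨
  - det N A                                               ∎
  where
  N = suc (suc n)
  A₀ = A fzero
  A₁ = A (fsuc fzero)
  c = pairCofactor (A ∘ fsuc ∘ fsuc)
  g : Fin N → Fin N → ℚ
  g b a = A₀ b * A₁ a * c b a
  rearrange : ∀ x y z → x * y * - z ≡ - (y * x * z)
  rearrange = solve-∀ ℚ-ring
  flip : ∀ b a → A₁ a * A₀ b * c a b ≡ - g b a
  flip b a = trans (cong (A₁ a * A₀ b *_) (pairCofactor-antisym (A ∘ fsuc ∘ fsuc) b a)) (rearrange (A₁ a) (A₀ b) (c b a))

≡-neg⇒≡0 : ∀ {p} → p ≡ - p → p ≡ 0ℚ
≡-neg⇒≡0 {p} p≡-p = *-cancelˡ-≡0 {p = 1ℚ + 1ℚ} (λ ()) (begin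
  (1ℚ + 1ℚ) * p ≡⟨ double p ⟩
  p + p         ≡⟨ cong (p +_) p≡-p ⟩
  p + - p       ≡⟨ ℚₚ.+-inverseʳ p ⟩
  0ℚ            ∎)
  where
  double : ∀ p → (1ℚ + 1ℚ) * p ≡ p + p
  double = solve-∀ ℚ-ring

det-equalRows₀₁ : ∀ n (A : Mat (suc (suc n))) → (∀ j → A fzero j ≡ A (fsuc fzero) j) → det (suc (suc n)) A ≡ 0ℚ
det-equalRows₀₁ n A A₀≗A₁ = ≡-neg⇒≡0 (trans (det-cong (suc (suc n)) swap≗A) (det-swap₀₁ n A))
  where
  swap≗A : ∀ i j → A i j ≡ swap₀₁ A i j
  swap≗A fzero           j = A₀≗A₁ j
  swap≗A (fsuc fzero)    j = sym (A₀≗A₁ j)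
  swap≗A (fsuc (fsuc i)) j = refl

-- Swapping rows 0 and 1 moves the copy of row 0 next to row r + 1; expanding along the new
-- row 0 then leaves minors whose rows 0 and r are equal.
det-equalRows : ∀ n (r : Fin n) (A : Mat (suc n)) → (∀ j → A fzero j ≡ A (fsuc r) j) → det (suc n) A ≡ 0ℚ
det-equalRows (suc n) fzero    A A₀≗Aᵣ = det-equalRows₀₁ n A A₀≗Aᵣ
det-equalRows (suc n) (fsuc r) A A₀≗Aᵣ =
  ℚₚ.neg-injective (trans (sym (det-swap₀₁ n A)) (sumFin-zero (suc (suc n)) term≡0))
  where
  minor : Fin (suc (suc n)) → Mat (suc n)
  minor k i j = swap₀₁ A (fsuc i) (punchIn k j)
  term≡0 : ∀ k → sgn k * swap₀₁ A fzero k * det (suc n) (minor k) ≡ 0ℚ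
  term≡0 k = trans (cong (sgn k * swap₀₁ A fzero k *_) (det-equalRows n r (minor k) (λ j → A₀≗Aᵣ (punchIn k j))))
                   (ℚₚ.*-zeroʳ (sgn k * swap₀₁ A fzero k))

det-linear₀ : ∀ n (u w : Fin (suc n) → ℚ) (B : Fin n → Fin (suc n) → ℚ) →
              det (suc n) ((λ j → u j - w j) ∷ B) ≡ det (suc n) (u ∷ B) - det (suc n) (w ∷ B)
det-linear₀ n u w B = trans (sumFin-cong (suc n) (λ k → distrib (sgn k) (u k) (w k) (minor k)))
                            (sumFin-- (suc n) (λ k → sgn k * u k * minor k) (λ k → sgn k * w k * minor k))
  where
  minor : Fin (suc n) → ℚ
  minor k = det n (λ i j → B i (punchIn k j))
  distrib : ∀ s a b d → s * (a - b) * d ≡ s * a * d - s * b * d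
  distrib = solve-∀ ℚ-ring

det-subtractRow₀ : ∀ n (A : Mat (suc (suc n))) →
                   det (suc (suc n)) (A fzero ∷ (λ j → A (fsuc fzero) j - A fzero j) ∷ A ∘ fsuc ∘ fsuc) ≡ det (suc (suc n)) A
det-subtractRow₀ n A = begin
  sumFin (suc (suc n)) (λ k → sgn k * A fzero k * det (suc n) ((λ j → A₁ k j - A₀ k j) ∷ R k))
    ≡⟨ sumFin-cong (suc (suc n)) (λ k → trans (cong (sgn k * A fzero k *_) (det-linear₀ n (A₁ k) (A₀ k) (R k)))
                                              (*-distribˡ-- (sgn k * A fzero k) (det (suc n) (A₁ k ∷ R k)) (det (suc n) (A₀ k ∷ R k)))) ⟩
  sumFin (suc (suc n)) (λ k → term (A fzero ∷ A ∘ fsuc) k - term (A fzero ∷ A fzero ∷ A ∘ fsuc ∘ fsuc) k)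
    ≡⟨ sumFin-- (suc (suc n)) (term (A fzero ∷ A ∘ fsuc)) (term (A fzero ∷ A fzero ∷ A ∘ fsuc ∘ fsuc)) ⟩
  det (suc (suc n)) A - det (suc (suc n)) (A fzero ∷ A fzero ∷ A ∘ fsuc ∘ fsuc)
    ≡⟨ cong (λ d → det (suc (suc n)) A - d) (det-equalRows₀₁ n (A fzero ∷ A fzero ∷ A ∘ fsuc ∘ fsuc) (λ j → refl)) ⟩
  det (suc (suc n)) A - 0ℚ
    ≡⟨ ℚₚ.+-identityʳ _ ⟩
  det (suc (suc n)) A ∎
  where
  A₀ A₁ : Fin (suc (suc n)) → Fin (suc n) → ℚ
  A₀ k j = A fzero (punchIn k j)
  A₁ k j = A (fsuc fzero) (punchIn k j)
  R : Fin (suc (suc n)) → Fin n → Fin (suc n) → ℚ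
  R k i j = A (fsuc (fsuc i)) (punchIn k j)
  term : Mat (suc (suc n)) → Fin (suc (suc n)) → ℚ
  term M k = sgn k * M fzero k * det (suc n) (λ i j → M (fsuc i) (punchIn k j))

Δ : ∀ {n} {C : Set} → (Fin (suc n) → C → ℚ) → Fin (suc n) → C → ℚ
Δ A fzero    j = A fzero j
Δ A (fsuc i) j = A (fsuc i) j - A (inject₁ i) j

-- Δ A is obtained from A by subtracting row 0 from row 1 of  A 0 ∷ Δ (tail A),
-- and Δ commutes with deleting a column, so induction runs through the minors.
det-Δ : ∀ n (A : Mat (suc n)) → det (suc n) (Δ A) ≡ det (suc n) A
det-Δ zero    A = refl
det-Δ (suc n) A = begin
  det (suc (suc n)) (Δ A)
    ≡⟨ det-cong (suc (suc n)) ΔA≗ ⟩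
  det (suc (suc n)) (A′ fzero ∷ (λ j → A′ (fsuc fzero) j - A′ fzero j) ∷ A′ ∘ fsuc ∘ fsuc)
    ≡⟨ det-subtractRow₀ n A′ ⟩
  det (suc (suc n)) A′
    ≡⟨ sumFin-cong (suc (suc n)) (λ k → cong (sgn k * A fzero k *_) (det-Δ n (λ i j → A (fsuc i) (punchIn k j)))) ⟩
  det (suc (suc n)) A ∎
  where
  A′ : Mat (suc (suc n))
  A′ = A fzero ∷ Δ (A ∘ fsuc)
  ΔA≗ : ∀ i j → Δ A i j ≡ (A′ fzero ∷ (λ j → A′ (fsuc fzero) j - A′ fzero j) ∷ A′ ∘ fsuc ∘ fsuc) i j
  ΔA≗ fzero           j = refl
  ΔA≗ (fsuc fzero)    j = refl
  ΔA≗ (fsuc (fsuc i)) j = refl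

det-triangular : ∀ n (A : Mat n) (d : ℕ → ℚ) →
                 (∀ i j → toℕ i < toℕ j → A i j ≡ 0ℚ) → (∀ i → A i i ≡ d (toℕ i)) → det n A ≡ prodTo n d
det-triangular zero    A d upper diag = refl
det-triangular (suc n) A d upper diag = begin
  det (suc n) A                                            ≡⟨ sumFin-single (suc n) fzero _ offDiagonal ⟩
  1ℚ * A fzero fzero * det n (λ i j → A (fsuc i) (fsuc j)) ≡⟨ cong₂ (λ a m → 1ℚ * a * m) (diag fzero) minor ⟩
  1ℚ * d 0 * prodTo n (d ∘ suc)                            ≡⟨ cong (_* prodTo n (d ∘ suc)) (ℚₚ.*-identityˡ (d 0)) ⟩
  d 0 * prodTo n (d ∘ suc)                                 ≡⟨ prodTo-sucˡ n d ⟨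
  prodTo (suc n) d                                         ∎
  where
  minor : det n (λ i j → A (fsuc i) (fsuc j)) ≡ prodTo n (d ∘ suc)
  minor = det-triangular n (λ i j → A (fsuc i) (fsuc j)) (d ∘ suc) (λ i j i<j → upper (fsuc i) (fsuc j) (s≤s i<j)) (diag ∘ fsuc)
  offDiagonal : ∀ k → k ≢ fzero → sgn k * A fzero k * det n (λ i j → A (fsuc i) (punchIn k j)) ≡ 0ℚ
  offDiagonal fzero    k≢0 = ⊥-elim (k≢0 refl)
  offDiagonal (fsuc k) _   = trans (cong (λ a → sgn (fsuc k) * a * minorₖ) (upper fzero (fsuc k) (s≤s z≤n)))
                                   (zero-middle (sgn (fsuc k)) minorₖ)
    where
    minorₖ = det n (λ i j → A (fsuc i) (punchIn (fsuc k) j))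
    zero-middle : ∀ a b → a * 0ℚ * b ≡ 0ℚ
    zero-middle = solve-∀ ℚ-ring

cofactor₀ : ∀ {m} → Mat (suc m) → Fin (suc m) → ℚ
cofactor₀ {m} D k = sgn k * det m (λ i j → D (fsuc i) (punchIn k j))

det-cofactor₀ : ∀ m (D : Mat (suc m)) → det (suc m) D ≡ sumFin (suc m) (λ k → D fzero k * cofactor₀ D k)
det-cofactor₀ m D = sumFin-cong (suc m) (λ k → exchange (sgn k) (D fzero k) (det m (λ i j → D (fsuc i) (punchIn k j))))
  where
  exchange : ∀ s a d → s * a * d ≡ a * (s * d)
  exchange = solve-∀ ℚ-ring

cofactor₀-kernel : ∀ m (D : Mat (suc m)) i → sumFin (suc m) (λ k → D (fsuc i) k * cofactor₀ D k) ≡ 0ℚ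
cofactor₀-kernel m D i = trans (sym (det-cofactor₀ m (D (fsuc i) ∷ D ∘ fsuc))) (det-equalRows m i (D (fsuc i) ∷ D ∘ fsuc) (λ j → refl))

module _ (m : ℕ) (D : Mat (suc m))
         (upper : ∀ i k → suc (toℕ i) < toℕ k → D (fsuc i) k ≡ 0ℚ) where

  kernel-trivial : (∀ i → D (fsuc i) (fsuc i) ≢ 0ℚ) → (e : Fin (suc m) → ℚ) → e fzero ≡ 0ℚ →
                   (∀ i → sumFin (suc m) (λ k → D (fsuc i) k * e k) ≡ 0ℚ) → ∀ k → e k ≡ 0ℚ
  kernel-trivial diag≢0 e e₀≡0 De≡0 k = below (toℕ k) k ℕₚ.≤-refl
    where
    below : ∀ n k → toℕ k ≤ n → e k ≡ 0ℚ
    below n       fzero    _         = e₀≡0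
    below (suc n) (fsuc i) (s≤s i≤n) = *-cancelˡ-≡0 (diag≢0 i)
      (trans (sym (sumFin-single (suc m) (fsuc i) (λ k → D (fsuc i) k * e k) offDiagonal)) (De≡0 i))
      where
      offDiagonal : ∀ k → k ≢ fsuc i → D (fsuc i) k * e k ≡ 0ℚ
      offDiagonal k k≢ with ℕₚ.<-cmp (toℕ k) (suc (toℕ i))
      ... | tri< k<i _ _ = trans (cong (D (fsuc i) k *_) (below n k (ℕₚ.≤-trans (ℕₚ.≤-pred k<i) i≤n))) (ℚₚ.*-zeroʳ (D (fsuc i) k))
      ... | tri≈ _ k≡i _ = ⊥-elim (k≢ (Finₚ.toℕ-injective k≡i))
      ... | tri> _ _ k>i = trans (cong (_* e k) (upper i k k>i)) (ℚₚ.*-zeroˡ (e k))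

  kernel-proportional : (∀ i → D (fsuc i) (fsuc i) ≢ 0ℚ) → (u v : Fin (suc m) → ℚ) → u fzero ≡ 1ℚ →
                        (∀ i → sumFin (suc m) (λ k → D (fsuc i) k * u k) ≡ 0ℚ) →
                        (∀ i → sumFin (suc m) (λ k → D (fsuc i) k * v k) ≡ 0ℚ) → ∀ k → v k ≡ v fzero * u k
  kernel-proportional diag≢0 u v u₀≡1 Du≡0 Dv≡0 k = x∙y⁻¹≈ε⇒x≈y (v k) (v fzero * u k) (kernel-trivial diag≢0 e e₀≡0 De≡0 k)
    where
    e : Fin (suc m) → ℚ
    e k = v k - v fzero * u k
    e₀≡0 : e fzero ≡ 0ℚ
    e₀≡0 = trans (cong (λ x → v fzero - v fzero * x) u₀≡1) (cancel (v fzero))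
      where
      cancel : ∀ a → a - a * 1ℚ ≡ 0ℚ
      cancel = solve-∀ ℚ-ring
    De≡0 : ∀ i → sumFin (suc m) (λ k → D (fsuc i) k * e k) ≡ 0ℚ
    De≡0 i = begin
      sumFin (suc m) (λ k → D (fsuc i) k * e k)
        ≡⟨ sumFin-cong (suc m) (λ k → expand (D (fsuc i) k) (v k) (v fzero) (u k)) ⟩
      sumFin (suc m) (λ k → D (fsuc i) k * v k - v fzero * (D (fsuc i) k * u k))
        ≡⟨ sumFin-- (suc m) (λ k → D (fsuc i) k * v k) (λ k → v fzero * (D (fsuc i) k * u k)) ⟩
      sumFin (suc m) (λ k → D (fsuc i) k * v k) - sumFin (suc m) (λ k → v fzero * (D (fsuc i) k * u k))
        ≡⟨ cong₂ _-_ (Dv≡0 i) (trans (sumFin-*ˡ (suc m) (v fzero) (λ k → D (fsuc i) k * u k)) (cong (v fzero *_) (Du≡0 i))) ⟩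
      0ℚ - v fzero * 0ℚ
        ≡⟨ cong (λ x → 0ℚ - x) (ℚₚ.*-zeroʳ (v fzero)) ⟩
      0ℚ ∎
      where
      expand : ∀ a b c d → a * (b - c * d) ≡ a * b - c * (a * d)
      expand = solve-∀ ℚ-ring

  -- The first-row cofactors lie in the kernel of the other rows, which is the line through u.
  det-byKernelVector : (d : ℕ → ℚ) → (∀ i → D (fsuc i) (fsuc i) ≡ d (toℕ i)) → (∀ r → r < m → d r ≢ 0ℚ) →
                       (u : Fin (suc m) → ℚ) → u fzero ≡ 1ℚ → (∀ i → sumFin (suc m) (λ k → D (fsuc i) k * u k) ≡ 0ℚ) →
                       det (suc m) D ≡ prodTo m d * sumFin (suc m) (λ k → D fzero k * u k)
  det-byKernelVector d diag d≢0 u u₀≡1 Du≡0 = begin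
    det (suc m) D                                           ≡⟨ det-cofactor₀ m D ⟩
    sumFin (suc m) (λ k → D fzero k * v k)                  ≡⟨ sumFin-cong (suc m) (λ k → cong (D fzero k *_) (v≡v₀u k)) ⟩
    sumFin (suc m) (λ k → D fzero k * (v fzero * u k))      ≡⟨ sumFin-cong (suc m) (λ k → exchange (D fzero k) (v fzero) (u k)) ⟩
    sumFin (suc m) (λ k → v fzero * (D fzero k * u k))      ≡⟨ sumFin-*ˡ (suc m) (v fzero) (λ k → D fzero k * u k) ⟩
    v fzero * sumFin (suc m) (λ k → D fzero k * u k)        ≡⟨ cong (_* sumFin (suc m) (λ k → D fzero k * u k)) v₀ ⟩
    prodTo m d * sumFin (suc m) (λ k → D fzero k * u k)     ∎
    where
    v = cofactor₀ D
    v₀ : v fzero ≡ prodTo m d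
    v₀ = trans (ℚₚ.*-identityˡ _) (det-triangular m (λ i j → D (fsuc i) (fsuc j)) d (λ i j i<j → upper i (fsuc j) (s≤s i<j)) diag)
    v≡v₀u : ∀ k → v k ≡ v fzero * u k
    v≡v₀u = kernel-proportional (λ i → d≢0 (toℕ i) (Finₚ.toℕ<n i) ∘ trans (sym (diag i))) u v u₀≡1 Du≡0 (cofactor₀-kernel m D)
    exchange : ∀ a b c → a * (b * c) ≡ b * (a * c)
    exchange = solve-∀ ℚ-ring

a-vanishes : ∀ m j → m < j → a m j ≡ 0ℚ
a-vanishes m j m<j = trans (cong (sign j *_) (pcoeff-vanishes m j m<j)) (ℚₚ.*-zeroʳ (sign j))
  where
  pcoeff-vanishes : ∀ m j → m < j → pcoeff m j ≡ 0ℚ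
  pcoeff-vanishes zero    (suc j) _         = refl
  pcoeff-vanishes (suc m) (suc j) (s≤s m<j) = begin
    pcoeff m (suc j) - pcoeff m j * (ℤ.+ 1 / suc m)
      ≡⟨ cong₂ (λ p q → p - q * (ℤ.+ 1 / suc m)) (pcoeff-vanishes m (suc j) (ℕₚ.m<n⇒m<1+n m<j)) (pcoeff-vanishes m j m<j) ⟩
    0ℚ - 0ℚ * (ℤ.+ 1 / suc m)
      ≡⟨ cong (λ q → 0ℚ - q) (ℚₚ.*-zeroˡ (ℤ.+ 1 / suc m)) ⟩
    0ℚ ∎

a-0≡1 : ∀ m → a m 0 ≡ 1ℚ
a-0≡1 zero    = refl
a-0≡1 (suc m) = a-0≡1 m

a-suc : ∀ m j → a (suc m) (suc j) ≡ a m (suc j) + a m j * ι⁻¹ (suc m)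
a-suc m j = begin
  - sign j * (pcoeff m (suc j) - pcoeff m j * (ℤ.+ 1 / suc m))
    ≡⟨ cong (λ q → - sign j * (pcoeff m (suc j) - pcoeff m j * q)) (ι⁻¹-suc≡1/suc m) ⟨
  - sign j * (pcoeff m (suc j) - pcoeff m j * ι⁻¹ (suc m))
    ≡⟨ expand (sign j) (pcoeff m (suc j)) (pcoeff m j) (ι⁻¹ (suc m)) ⟩
  - sign j * pcoeff m (suc j) + sign j * pcoeff m j * ι⁻¹ (suc m) ∎
  where
  expand : ∀ s p q r → - s * (p - q * r) ≡ - s * p + s * q * r
  expand = solve-∀ ℚ-ring

sumTo-a*ι⁻¹ : ∀ r i → sumTo r (λ k → a k i * ι⁻¹ (suc k)) ≡ a r (suc i)
sumTo-a*ι⁻¹ zero    i = sym (a-vanishes 0 (suc i) (s≤s z≤n))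
sumTo-a*ι⁻¹ (suc r) i = trans (cong (_+ a r i * ι⁻¹ (suc r)) (sumTo-a*ι⁻¹ r i)) (sym (a-suc r i))

inv*inv : ∀ {p q} → p ≢ 0ℚ → q ≢ 0ℚ → p + q ≢ 0ℚ → inv p * inv q ≡ inv (p + q) * (inv p + inv q)
inv*inv {p} {q} p≢0 q≢0 p+q≢0 = begin
  ip * iq                          ≡⟨ ℚₚ.*-identityˡ (ip * iq) ⟨
  1ℚ * (ip * iq)                   ≡⟨ cong (_* (ip * iq)) (inv-inverseˡ p+q≢0) ⟨
  is * (p + q) * (ip * iq)         ≡⟨ expand is p q ip iq ⟩
  is * (p * ip * iq + q * iq * ip) ≡⟨ cong₂ (λ x y → is * (x * iq + y * ip)) (inv-inverseʳ p≢0) (inv-inverseʳ q≢0) ⟩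
  is * (1ℚ * iq + 1ℚ * ip)         ≡⟨ simplify is ip iq ⟩
  is * (ip + iq)                   ∎
  where
  ip = inv p
  iq = inv q
  is = inv (p + q)
  expand : ∀ s p q a b → s * (p + q) * (a * b) ≡ s * (p * a * b + q * b * a)
  expand = solve-∀ ℚ-ring
  simplify : ∀ s a b → s * (1ℚ * b + 1ℚ * a) ≡ s * (a + b)
  simplify = solve-∀ ℚ-ring

ι⁻¹*ι⁻¹ : ∀ {k r} → k < r → ι⁻¹ (suc k) * ι⁻¹ (r ∸ k) ≡ ι⁻¹ (suc r) * (ι⁻¹ (suc k) + ι⁻¹ (r ∸ k))
ι⁻¹*ι⁻¹ {k} {r} k<r = trans (inv*inv (ι-suc≢0 k) r-k≢0 sum≢0) (cong (λ q → inv q * (ι⁻¹ (suc k) + ι⁻¹ (r ∸ k))) sum≡)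
  where
  r∸k≡ : r ∸ k ≡ suc (r ∸ suc k)
  r∸k≡ = ℕₚ.+-∸-assoc 1 k<r
  r-k≢0 : ι (r ∸ k) ≢ 0ℚ
  r-k≢0 = ι-suc≢0 (r ∸ suc k) ∘ trans (cong ι (sym r∸k≡))
  sum≡ : ι (suc k) + ι (r ∸ k) ≡ ι (suc r)
  sum≡ = trans (sym (ι-+ (suc k) (r ∸ k))) (cong (ι ∘ suc) (ℕₚ.m+[n∸m]≡n (ℕₚ.<⇒≤ k<r)))
  sum≢0 : ι (suc k) + ι (r ∸ k) ≢ 0ℚ
  sum≢0 = ι-suc≢0 r ∘ trans (sym sum≡)

a-suc*ι⁻¹ : ∀ {k r} i → k < r →
            a (suc k) (suc i) * ι⁻¹ (r ∸ k) ≡ a k (suc i) * ι⁻¹ (r ∸ k) + ι⁻¹ (suc r) * (a k i * ι⁻¹ (suc k) + a k i * ι⁻¹ (r ∸ k))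
a-suc*ι⁻¹ {k} {r} i k<r = begin
  a (suc k) (suc i) * c                       ≡⟨ cong (_* c) (a-suc k i) ⟩
  (a k (suc i) + a k i * ι⁻¹ (suc k)) * c     ≡⟨ expand (a k (suc i)) (a k i) (ι⁻¹ (suc k)) c ⟩
  a k (suc i) * c + a k i * (ι⁻¹ (suc k) * c) ≡⟨ cong (λ y → a k (suc i) * c + a k i * y) (ι⁻¹*ι⁻¹ k<r) ⟩
  a k (suc i) * c + a k i * (R * (ι⁻¹ (suc k) + c)) ≡⟨ cong (a k (suc i) * c +_) (exchange (a k i) R (ι⁻¹ (suc k)) c) ⟩
  a k (suc i) * c + R * (a k i * ι⁻¹ (suc k) + a k i * c) ∎
  where
  c = ι⁻¹ (r ∸ k)
  R = ι⁻¹ (suc r)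
  expand : ∀ x y p q → (x + y * p) * q ≡ x * q + y * (p * q)
  expand = solve-∀ ℚ-ring
  exchange : ∀ y c p q → y * (c * (p + q)) ≡ c * (y * p + y * q)
  exchange = solve-∀ ℚ-ring

a-convolution : ∀ r i → sumTo r (λ k → a k i * ι⁻¹ (r ∸ k)) ≡ ι (suc i) * a r (suc i)
a-convolution zero    i = sym (trans (cong (ι (suc i) *_) (a-vanishes 0 (suc i) (s≤s z≤n))) (ℚₚ.*-zeroʳ (ι (suc i))))
a-convolution (suc r) zero = begin
  sumTo (suc r) (λ k → a k 0 * ι⁻¹ (suc r ∸ k))           ≡⟨ sumTo-sucˡ r _ ⟩
  a 0 0 * ι⁻¹ (suc r) + sumTo r (λ k → a k 0 * ι⁻¹ (r ∸ k)) ≡⟨ cong (1ℚ * ι⁻¹ (suc r) +_) (a-convolution r 0) ⟩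
  1ℚ * ι⁻¹ (suc r) + 1ℚ * a r 1                           ≡⟨ rearrange (ι⁻¹ (suc r)) (a r 1) ⟩
  1ℚ * (a r 1 + 1ℚ * ι⁻¹ (suc r))                         ≡⟨ cong (λ x → 1ℚ * (a r 1 + x * ι⁻¹ (suc r))) (a-0≡1 r) ⟨
  1ℚ * (a r 1 + a r 0 * ι⁻¹ (suc r))                      ≡⟨ cong (1ℚ *_) (a-suc r 0) ⟨
  ι 1 * a (suc r) 1                                       ∎
  where
  rearrange : ∀ c x → 1ℚ * c + 1ℚ * x ≡ 1ℚ * (x + 1ℚ * c)
  rearrange = solve-∀ ℚ-ring
a-convolution (suc r) (suc i) = begin
  sumTo (suc r) (λ k → a k (suc i) * ι⁻¹ (suc r ∸ k))
    ≡⟨ sumTo-sucˡ r _ ⟩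
  a 0 (suc i) * R + sumTo r (λ k → a (suc k) (suc i) * c k)
    ≡⟨ cong₂ _+_ (trans (cong (_* R) (a-vanishes 0 (suc i) (s≤s z≤n))) (ℚₚ.*-zeroˡ R)) (sumTo-cong r (λ k → a-suc*ι⁻¹ i)) ⟩
  0ℚ + sumTo r (λ k → a k (suc i) * c k + R * (a k i * ι⁻¹ (suc k) + a k i * c k))
    ≡⟨ trans (ℚₚ.+-identityˡ _) (sumTo-+ r _ _) ⟩
  S r (suc i) + sumTo r (λ k → R * (a k i * ι⁻¹ (suc k) + a k i * c k))
    ≡⟨ cong (S r (suc i) +_) (trans (sumTo-*ˡ r R _) (cong (R *_) (sumTo-+ r _ _))) ⟩
  S r (suc i) + R * (sumTo r (λ k → a k i * ι⁻¹ (suc k)) + S r i)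
    ≡⟨ cong₂ (λ x y → x + R * y) (a-convolution r (suc i)) (cong₂ _+_ (sumTo-a*ι⁻¹ r i) (a-convolution r i)) ⟩
  ι (suc (suc i)) * a r (suc (suc i)) + R * (a r (suc i) + ι (suc i) * a r (suc i))
    ≡⟨ cong (λ x → x * a r (suc (suc i)) + R * (a r (suc i) + ι (suc i) * a r (suc i))) (ι-suc (suc i)) ⟩
  (1ℚ + ι (suc i)) * a r (suc (suc i)) + R * (a r (suc i) + ι (suc i) * a r (suc i))
    ≡⟨ factor (ι (suc i)) (a r (suc (suc i))) R (a r (suc i)) ⟩
  (1ℚ + ι (suc i)) * (a r (suc (suc i)) + a r (suc i) * R)
    ≡⟨ cong₂ _*_ (ι-suc (suc i)) (a-suc r (suc i)) ⟨
  ι (suc (suc i)) * a (suc r) (suc (suc i)) ∎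
  where
  R = ι⁻¹ (suc r)
  c : ℕ → ℚ
  c k = ι⁻¹ (r ∸ k)
  S : ℕ → ℕ → ℚ
  S r i = sumTo r (λ k → a k i * ι⁻¹ (r ∸ k))
  factor : ∀ j x c y → (1ℚ + j) * x + c * (y + j * y) ≡ (1ℚ + j) * (x + y * c)
  factor = solve-∀ ℚ-ring

β : ℕ → ℚ
β n = headQ (bernTable n)

-- Defs keeps the recursion step of bernTable private; it is recovered as the solution of the
-- unification problem that the with-abstraction in β-suc poses.
mutual
  bernStep : ℕ → List ℚ → ℚ
  bernStep = _

  β-suc : ∀ n → β (suc n) ≡ - bernStep 0 (bernTable n)
  β-suc n with 0 | bernTable n
  ... | i | cs = refl

fact⁻¹ : ℕ → ℚ
fact⁻¹ n = inv (fact n)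

fact⁻¹-suc : ∀ n → fact⁻¹ n ≡ ι (suc n) * fact⁻¹ (suc n)
fact⁻¹-suc n = sym (begin
  ι (suc n) * inv (ι (suc n) * fact n)              ≡⟨ cong (ι (suc n) *_) (inv-*-distrib (ι-suc≢0 n) (fact≢0 n)) ⟩
  ι (suc n) * (inv (ι (suc n)) * inv (fact n))      ≡⟨ ℚₚ.*-assoc (ι (suc n)) _ _ ⟨
  ι (suc n) * inv (ι (suc n)) * inv (fact n)        ≡⟨ cong (_* inv (fact n)) (inv-inverseʳ (ι-suc≢0 n)) ⟩
  1ℚ * inv (fact n)                                 ≡⟨ ℚₚ.*-identityˡ _ ⟩
  fact⁻¹ n                                          ∎)

bernStep-sum : ∀ n i → bernStep i (bernTable n) ≡ sumTo (suc n) (λ l → β (n ∸ l) * fact⁻¹ (i ℕ.+ l ℕ.+ 2))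
bernStep-sum zero    i = begin
  1ℚ * fact⁻¹ (i ℕ.+ 2) + 0ℚ       ≡⟨ cong (λ j → 1ℚ * fact⁻¹ (j ℕ.+ 2) + 0ℚ) (ℕₚ.+-identityʳ i) ⟨
  1ℚ * fact⁻¹ (i ℕ.+ 0 ℕ.+ 2) + 0ℚ ≡⟨ ℚₚ.+-comm (1ℚ * fact⁻¹ (i ℕ.+ 0 ℕ.+ 2)) 0ℚ ⟩
  0ℚ + 1ℚ * fact⁻¹ (i ℕ.+ 0 ℕ.+ 2) ∎
bernStep-sum (suc n) i = begin
  β (suc n) * fact⁻¹ (i ℕ.+ 2) + bernStep (suc i) (bernTable n)
    ≡⟨ cong₂ _+_ (cong (λ j → β (suc n) * fact⁻¹ (j ℕ.+ 2)) (sym (ℕₚ.+-identityʳ i))) (bernStep-sum n (suc i)) ⟩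
  β (suc n) * fact⁻¹ (i ℕ.+ 0 ℕ.+ 2) + sumTo (suc n) (λ l → β (n ∸ l) * fact⁻¹ (suc i ℕ.+ l ℕ.+ 2))
    ≡⟨ cong (β (suc n) * fact⁻¹ (i ℕ.+ 0 ℕ.+ 2) +_)
            (sumTo-cong (suc n) (λ l _ → cong (λ j → β (n ∸ l) * fact⁻¹ (j ℕ.+ 2)) (sym (ℕₚ.+-suc i l)))) ⟩
  β (suc n) * fact⁻¹ (i ℕ.+ 0 ℕ.+ 2) + sumTo (suc n) (λ l → β (n ∸ l) * fact⁻¹ (i ℕ.+ suc l ℕ.+ 2))
    ≡⟨ sumTo-sucˡ (suc n) (λ l → β (suc n ∸ l) * fact⁻¹ (i ℕ.+ l ℕ.+ 2)) ⟨
  sumTo (suc (suc n)) (λ l → β (suc n ∸ l) * fact⁻¹ (i ℕ.+ l ℕ.+ 2)) ∎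

δ₁ : ℕ → ℚ
δ₁ 1 = 1ℚ
δ₁ _ = 0ℚ

-- Compare coefficients of zⁿ in (z/(eᶻ - 1))·eᶻ = z/(eᶻ - 1) + z.
β-recurrence : ∀ n → sumTo (suc n) (λ k → β k * fact⁻¹ (n ∸ k)) ≡ β n + δ₁ n
β-recurrence zero          = refl
β-recurrence (suc zero)    = refl
β-recurrence (suc (suc N)) = begin
  sumTo (suc N) (λ k → β k * fact⁻¹ (suc (suc N) ∸ k)) + β (suc N) * fact⁻¹ (suc N ∸ N) + β (suc (suc N)) * fact⁻¹ (N ∸ N)
    ≡⟨ cong₂ (λ x d → x + β (suc (suc N)) * fact⁻¹ d) lower-terms≡0 (ℕₚ.n∸n≡0 N) ⟩
  0ℚ + β (suc (suc N)) * 1ℚ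
    ≡⟨ trans (ℚₚ.+-identityˡ _) (trans (ℚₚ.*-identityʳ (β (suc (suc N)))) (sym (ℚₚ.+-identityʳ (β (suc (suc N)))))) ⟩
  β (suc (suc N)) + 0ℚ ∎
  where
  g : ℕ → ℚ
  g k = β k * fact⁻¹ ((N ∸ k) ℕ.+ 2)
  suc-N∸N : suc N ∸ N ≡ 1
  suc-N∸N = trans (ℕₚ.+-∸-assoc 1 (ℕₚ.≤-refl {N})) (cong suc (ℕₚ.n∸n≡0 N))
  lower-terms≡0 : sumTo (suc N) (λ k → β k * fact⁻¹ (suc (suc N) ∸ k)) + β (suc N) * fact⁻¹ (suc N ∸ N) ≡ 0ℚ
  lower-terms≡0 = begin
    sumTo (suc N) (λ k → β k * fact⁻¹ (suc (suc N) ∸ k)) + β (suc N) * fact⁻¹ (suc N ∸ N)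
      ≡⟨ cong₂ _+_ (sumTo-cong (suc N) (λ k k≤N → cong (λ d → β k * fact⁻¹ d)
                     (trans (cong (_∸ k) (ℕₚ.+-comm 2 N)) (ℕₚ.+-∸-comm 2 (ℕₚ.≤-pred k≤N)))))
                   (trans (cong (λ d → β (suc N) * fact⁻¹ d) suc-N∸N) (ℚₚ.*-identityʳ (β (suc N)))) ⟩
    sumTo (suc N) g + β (suc N)
      ≡⟨ cong (sumTo (suc N) g +_) (trans (β-suc N) (cong -_ (bernStep-sum N 0))) ⟩
    sumTo (suc N) g + - sumTo (suc N) (λ l → β (N ∸ l) * fact⁻¹ (l ℕ.+ 2))
      ≡⟨ cong (λ x → sumTo (suc N) g + - x) (trans (sumTo-cong (suc N) (λ l l≤N → cong (λ d → β (N ∸ l) * fact⁻¹ (d ℕ.+ 2))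
                                                    (sym (ℕₚ.m∸[m∸n]≡n (ℕₚ.≤-pred l≤N)))))
                                                  (sumTo-reverse N g)) ⟩
    sumTo (suc N) g + - sumTo (suc N) g
      ≡⟨ ℚₚ.+-inverseʳ (sumTo (suc N) g) ⟩
    0ℚ ∎

guard≤ : ℕ → ℕ → ℚ → ℚ
guard≤ zero    n       q = q
guard≤ (suc k) zero    q = 0ℚ
guard≤ (suc k) (suc n) q = guard≤ k n q

guard≤-yes : ∀ {k n} q → k ≤ n → guard≤ k n q ≡ q
guard≤-yes {zero}          q _         = refl
guard≤-yes {suc k} {suc n} q (s≤s k≤n) = guard≤-yes q k≤n

guard≤-no : ∀ {k n} q → n < k → guard≤ k n q ≡ 0ℚ
guard≤-no {suc k} {zero}  q _         = refl
guard≤-no {suc k} {suc n} q (s≤s n<k) = guard≤-no q n<k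

guard≤-*ˡ : ∀ k n c q → guard≤ k n (c * q) ≡ c * guard≤ k n q
guard≤-*ˡ zero    n       c q = refl
guard≤-*ˡ (suc k) zero    c q = sym (ℚₚ.*-zeroʳ c)
guard≤-*ˡ (suc k) (suc n) c q = guard≤-*ˡ k n c q

guard≤-complement : ∀ r k q → guard≤ (suc r) k q ≡ q - guard≤ k r q
guard≤-complement r       zero    q = sym (ℚₚ.+-inverseʳ q)
guard≤-complement zero    (suc k) q = sym (ℚₚ.+-identityʳ q)
guard≤-complement (suc r) (suc k) q = guard≤-complement r k q

sumTo-guard≤ : ∀ N n (g : ℕ → ℚ) → n < N → sumTo N (λ k → guard≤ k n (g k)) ≡ sumTo (suc n) g
sumTo-guard≤ N n g n<N = begin
  sumTo N (λ k → guard≤ k n (g k))       ≡⟨ sumTo-extend (suc n) N _ n<N (λ k n<k → guard≤-no (g k) n<k) ⟩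
  sumTo (suc n) (λ k → guard≤ k n (g k)) ≡⟨ sumTo-cong (suc n) (λ k k≤n → guard≤-yes (g k) (ℕₚ.≤-pred k≤n)) ⟩
  sumTo (suc n) g                        ∎

-- A sequence φ encodes the polynomial Σₙ φₙ tⁿ/n!.  Then  umbral N φ  is its umbral evaluation
-- Σₙ φₙ Bₙ/n!,  shift N φ  encodes f(t + 1),  t· φ  encodes t f(t)  and  [t+ c ]· φ  encodes
-- (t + c) f(t);  N is a bound on the degree.
umbral : ℕ → (ℕ → ℚ) → ℚ
umbral N φ = sumTo N (λ n → φ n * β n)

shiftKernel : ℕ → ℕ → ℚ
shiftKernel k n = guard≤ k n (fact⁻¹ (n ∸ k))

shift : ℕ → (ℕ → ℚ) → ℕ → ℚ
shift N φ k = sumTo N (λ n → φ n * shiftKernel k n)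

t·_ : (ℕ → ℚ) → ℕ → ℚ
(t· φ) zero    = 0ℚ
(t· φ) (suc n) = ι (suc n) * φ n

[t+_]·_ : ℚ → (ℕ → ℚ) → ℕ → ℚ
([t+ c ]· φ) n = (t· φ) n + c * φ n

δ₀ : ℕ → ℚ
δ₀ zero    = 1ℚ
δ₀ (suc n) = 0ℚ

δ₁-sum : ∀ N (φ : ℕ → ℚ) → 2 ≤ N → sumTo N (λ n → φ n * δ₁ n) ≡ φ 1
δ₁-sum N φ 2≤N = trans (sumTo-extend 2 N (λ n → φ n * δ₁ n) 2≤N beyond) (simplify (φ 0) (φ 1))
  where
  beyond : ∀ k → 2 ≤ k → φ k * δ₁ k ≡ 0ℚ
  beyond (suc zero)    (s≤s ())
  beyond (suc (suc k)) _ = ℚₚ.*-zeroʳ (φ (suc (suc k)))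
  simplify : ∀ x y → 0ℚ + x * 0ℚ + y * 1ℚ ≡ y
  simplify = solve-∀ ℚ-ring

-- f(B + 1) = f(B) + f′(0)
umbral-shift : ∀ N (φ : ℕ → ℚ) → 2 ≤ N → umbral N (shift N φ) ≡ umbral N φ + φ 1
umbral-shift N φ 2≤N = begin
  sumTo N (λ k → shift N φ k * β k)
    ≡⟨ sumTo-cong N (λ k _ → sym (sumTo-*ʳ N (β k) (λ n → φ n * shiftKernel k n))) ⟩
  sumTo N (λ k → sumTo N (λ n → φ n * shiftKernel k n * β k))
    ≡⟨ sumTo-comm N N (λ k n → φ n * shiftKernel k n * β k) ⟩
  sumTo N (λ n → sumTo N (λ k → φ n * shiftKernel k n * β k))
    ≡⟨ sumTo-cong N (λ n _ → trans (sumTo-cong N (λ k _ → move-β n k)) (sumTo-*ˡ N (φ n) (g n))) ⟩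
  sumTo N (λ n → φ n * sumTo N (g n))
    ≡⟨ sumTo-cong N (λ n n<N → cong (φ n *_) (trans (sumTo-guard≤ N n (λ k → β k * fact⁻¹ (n ∸ k)) n<N) (β-recurrence n))) ⟩
  sumTo N (λ n → φ n * (β n + δ₁ n))
    ≡⟨ trans (sumTo-cong N (λ n _ → ℚₚ.*-distribˡ-+ (φ n) (β n) (δ₁ n))) (sumTo-+ N (λ n → φ n * β n) (λ n → φ n * δ₁ n)) ⟩
  umbral N φ + sumTo N (λ n → φ n * δ₁ n)
    ≡⟨ cong (umbral N φ +_) (δ₁-sum N φ 2≤N) ⟩
  umbral N φ + φ 1 ∎
  where
  g : ℕ → ℕ → ℚ
  g n k = guard≤ k n (β k * fact⁻¹ (n ∸ k))
  move-β : ∀ n k → φ n * shiftKernel k n * β k ≡ φ n * g n k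
  move-β n k = trans (ℚₚ.*-assoc (φ n) (shiftKernel k n) (β k))
                     (cong (φ n *_) (trans (ℚₚ.*-comm (shiftKernel k n) (β k)) (sym (guard≤-*ˡ k n (β k) (fact⁻¹ (n ∸ k))))))

shift-cong : ∀ N {φ ψ : ℕ → ℚ} → (∀ n → φ n ≡ ψ n) → ∀ k → shift N φ k ≡ shift N ψ k
shift-cong N φ≗ψ k = sumTo-cong N (λ n _ → cong (_* shiftKernel k n) (φ≗ψ n))

shift-*ˡ : ∀ N c (φ : ℕ → ℚ) k → shift N (λ n → c * φ n) k ≡ c * shift N φ k
shift-*ˡ N c φ k = trans (sumTo-cong N (λ n _ → ℚₚ.*-assoc c (φ n) (shiftKernel k n)))
                         (sumTo-*ˡ N c (λ n → φ n * shiftKernel k n))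

shift-+ : ∀ N (φ ψ : ℕ → ℚ) k → shift N (λ n → φ n + ψ n) k ≡ shift N φ k + shift N ψ k
shift-+ N φ ψ k = trans (sumTo-cong N (λ n _ → ℚₚ.*-distribʳ-+ (shiftKernel k n) (φ n) (ψ n)))
                        (sumTo-+ N (λ n → φ n * shiftKernel k n) (λ n → ψ n * shiftKernel k n))

shift-suc : ∀ N (φ : ℕ → ℚ) → φ N ≡ 0ℚ → ∀ k → shift (suc N) φ k ≡ shift N φ k
shift-suc N φ φN≡0 k = begin
  shift N φ k + φ N * shiftKernel k N ≡⟨ cong (λ x → shift N φ k + x * shiftKernel k N) φN≡0 ⟩
  shift N φ k + 0ℚ * shiftKernel k N  ≡⟨ cong (shift N φ k +_) (ℚₚ.*-zeroˡ (shiftKernel k N)) ⟩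
  shift N φ k + 0ℚ                    ≡⟨ ℚₚ.+-identityʳ (shift N φ k) ⟩
  shift N φ k                         ∎

shiftKernel-pascal : ∀ k n → ι (suc n) * shiftKernel k n ≡ ι (suc k) * shiftKernel k n + shiftKernel (suc k) n
shiftKernel-pascal zero    zero    = sym (ℚₚ.+-identityʳ _)
shiftKernel-pascal zero    (suc n) = begin
  ι (suc (suc n)) * fact⁻¹ (suc n)             ≡⟨ cong (_* fact⁻¹ (suc n)) (ι-suc (suc n)) ⟩
  (1ℚ + ι (suc n)) * fact⁻¹ (suc n)            ≡⟨ ℚₚ.*-distribʳ-+ (fact⁻¹ (suc n)) 1ℚ (ι (suc n)) ⟩
  1ℚ * fact⁻¹ (suc n) + ι (suc n) * fact⁻¹ (suc n) ≡⟨ cong (1ℚ * fact⁻¹ (suc n) +_) (fact⁻¹-suc n) ⟨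
  ι 1 * fact⁻¹ (suc n) + fact⁻¹ n              ∎
shiftKernel-pascal (suc k) zero    = simplify (ι (suc (suc k)))
  where
  simplify : ∀ x → 0ℚ ≡ x * 0ℚ + 0ℚ
  simplify = solve-∀ ℚ-ring
shiftKernel-pascal (suc k) (suc n) = begin
  ι (suc (suc n)) * K                  ≡⟨ cong (_* K) (ι-suc (suc n)) ⟩
  (1ℚ + ι (suc n)) * K                 ≡⟨ ℚₚ.*-distribʳ-+ K 1ℚ (ι (suc n)) ⟩
  1ℚ * K + ι (suc n) * K               ≡⟨ cong (1ℚ * K +_) (shiftKernel-pascal k n) ⟩
  1ℚ * K + (ι (suc k) * K + K′)        ≡⟨ regroup K (ι (suc k)) K′ ⟩
  (1ℚ + ι (suc k)) * K + K′            ≡⟨ cong (λ x → x * K + K′) (ι-suc (suc k)) ⟨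
  ι (suc (suc k)) * K + K′             ∎
  where
  K  = shiftKernel k n
  K′ = shiftKernel (suc k) n
  regroup : ∀ f i g → 1ℚ * f + (i * f + g) ≡ (1ℚ + i) * f + g
  regroup = solve-∀ ℚ-ring

ι*shiftKernel : ∀ k n → ι (suc n) * shiftKernel k (suc n) ≡ (t· (λ j → shiftKernel j n)) k + shiftKernel k n
ι*shiftKernel zero    n = trans (sym (fact⁻¹-suc n)) (sym (ℚₚ.+-identityˡ (fact⁻¹ n)))
ι*shiftKernel (suc k) n = shiftKernel-pascal k n

t·-cong : ∀ {φ ψ : ℕ → ℚ} → (∀ n → φ n ≡ ψ n) → ∀ k → (t· φ) k ≡ (t· ψ) k
t·-cong φ≗ψ zero    = refl
t·-cong φ≗ψ (suc k) = cong (ι (suc k) *_) (φ≗ψ k)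

t·-*ˡ : ∀ c (φ : ℕ → ℚ) k → (t· (λ j → c * φ j)) k ≡ c * (t· φ) k
t·-*ˡ c φ zero    = sym (ℚₚ.*-zeroʳ c)
t·-*ˡ c φ (suc k) = exchange (ι (suc k)) c (φ k)
  where
  exchange : ∀ i c x → i * (c * x) ≡ c * (i * x)
  exchange = solve-∀ ℚ-ring

t·-sumTo : ∀ N (ψ : ℕ → ℕ → ℚ) k → (t· (λ j → sumTo N (λ n → ψ n j))) k ≡ sumTo N (λ n → (t· ψ n) k)
t·-sumTo N ψ zero    = sym (sumTo-zero N (λ _ _ → refl))
t·-sumTo N ψ (suc k) = sym (sumTo-*ˡ N (ι (suc k)) (λ n → ψ n k))

shift-t· : ∀ N (φ : ℕ → ℚ) → φ N ≡ 0ℚ → ∀ k → shift (suc N) (t· φ) k ≡ (t· shift (suc N) φ) k + shift (suc N) φ k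
shift-t· N φ φN≡0 k = begin
  shift (suc N) (t· φ) k
    ≡⟨ sumTo-sucˡ N (λ n → (t· φ) n * shiftKernel k n) ⟩
  0ℚ * shiftKernel k 0 + sumTo N (λ n → ι (suc n) * φ n * shiftKernel k (suc n))
    ≡⟨ trans (cong (_+ S) (ℚₚ.*-zeroˡ (shiftKernel k 0))) (ℚₚ.+-identityˡ S) ⟩
  sumTo N (λ n → ι (suc n) * φ n * shiftKernel k (suc n))
    ≡⟨ sumTo-cong N (λ n _ → trans (exchange (ι (suc n)) (φ n) (shiftKernel k (suc n))) (cong (φ n *_) (ι*shiftKernel k n))) ⟩
  sumTo N (λ n → φ n * ((t· column n) k + shiftKernel k n))
    ≡⟨ trans (sumTo-cong N (λ n _ → ℚₚ.*-distribˡ-+ (φ n) _ _)) (sumTo-+ N _ (λ n → φ n * shiftKernel k n)) ⟩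
  sumTo N (λ n → φ n * (t· column n) k) + shift N φ k
    ≡⟨ cong (_+ shift N φ k) (sumTo-cong N (λ n _ → t·-*ˡ (φ n) (column n) k)) ⟨
  sumTo N (λ n → (t· (λ j → φ n * column n j)) k) + shift N φ k
    ≡⟨ cong (_+ shift N φ k) (t·-sumTo N (λ n j → φ n * column n j) k) ⟨
  (t· shift N φ) k + shift N φ k
    ≡⟨ cong₂ _+_ (t·-cong (λ j → sym (shift-suc N φ φN≡0 j)) k) (sym (shift-suc N φ φN≡0 k)) ⟩
  (t· shift (suc N) φ) k + shift (suc N) φ k ∎
  where
  S = sumTo N (λ n → ι (suc n) * φ n * shiftKernel k (suc n))
  column : ℕ → ℕ → ℚ
  column n j = shiftKernel j n
  exchange : ∀ i x y → i * x * y ≡ x * (i * y)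
  exchange = solve-∀ ℚ-ring

shift-[t+] : ∀ N (φ : ℕ → ℚ) c → φ N ≡ 0ℚ → ∀ k → shift (suc N) ([t+ c ]· φ) k ≡ ([t+ c + 1ℚ ]· shift (suc N) φ) k
shift-[t+] N φ c φN≡0 k = begin
  shift (suc N) ([t+ c ]· φ) k                                   ≡⟨ shift-+ (suc N) (t· φ) (λ n → c * φ n) k ⟩
  shift (suc N) (t· φ) k + shift (suc N) (λ n → c * φ n) k      ≡⟨ cong₂ _+_ (shift-t· N φ φN≡0 k) (shift-*ˡ (suc N) c φ k) ⟩
  (t· Sφ) k + Sφ k + c * Sφ k                                    ≡⟨ ℚₚ.+-assoc ((t· Sφ) k) (Sφ k) (c * Sφ k) ⟩
  (t· Sφ) k + (Sφ k + c * Sφ k)                                  ≡⟨ cong ((t· Sφ) k +_) (collect (Sφ k) c) ⟩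
  ([t+ c + 1ℚ ]· Sφ) k                                           ∎
  where
  Sφ = shift (suc N) φ
  collect : ∀ x c → x + c * x ≡ (c + 1ℚ) * x
  collect = solve-∀ ℚ-ring

-- pₑ r encodes Σⱼ a_{r,j} tʲ = p_r(-t) = (1 + t)(1 + t/2)⋯(1 + t/r);  gₑ r encodes
-- p_r(-(t - 1)) = t(t + 1)⋯(t + r - 1)/r!,  so that shifting gₑ r gives pₑ r.
pₑ : ℕ → ℕ → ℚ
pₑ r n = a r n * fact n

gₑ : ℕ → ℕ → ℚ
gₑ zero      = δ₀
gₑ (suc r) n = ι⁻¹ (suc r) * (t· pₑ r) n

pₑ-vanishes : ∀ r n → r < n → pₑ r n ≡ 0ℚ
pₑ-vanishes r n r<n = trans (cong (_* fact n) (a-vanishes r n r<n)) (ℚₚ.*-zeroˡ (fact n))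

pₑ-zero : ∀ n → pₑ 0 n ≡ δ₀ n
pₑ-zero zero    = refl
pₑ-zero (suc n) = pₑ-vanishes 0 (suc n) (s≤s z≤n)

gₑ-vanishes : ∀ r n → r < n → gₑ r n ≡ 0ℚ
gₑ-vanishes zero    (suc n) _         = refl
gₑ-vanishes (suc r) (suc n) (s≤s r<n) = begin
  ι⁻¹ (suc r) * (ι (suc n) * pₑ r n) ≡⟨ cong (λ x → ι⁻¹ (suc r) * (ι (suc n) * x)) (pₑ-vanishes r n r<n) ⟩
  ι⁻¹ (suc r) * (ι (suc n) * 0ℚ)     ≡⟨ cong (ι⁻¹ (suc r) *_) (ℚₚ.*-zeroʳ (ι (suc n))) ⟩
  ι⁻¹ (suc r) * 0ℚ                   ≡⟨ ℚₚ.*-zeroʳ (ι⁻¹ (suc r)) ⟩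
  0ℚ                                 ∎

pₑ-suc : ∀ r n → pₑ (suc r) n ≡ ι⁻¹ (suc r) * ([t+ ι (suc r) ]· pₑ r) n
pₑ-suc r zero    = begin
  a (suc r) 0 * 1ℚ                   ≡⟨ cong₂ _*_ (a-0≡1 (suc r)) (sym (ι⁻¹-inverseˡ r)) ⟩
  1ℚ * (R * ι (suc r))               ≡⟨ rearrange R (ι (suc r)) ⟩
  R * (0ℚ + ι (suc r) * (1ℚ * 1ℚ))   ≡⟨ cong (λ x → R * (0ℚ + ι (suc r) * (x * 1ℚ))) (a-0≡1 r) ⟨
  R * (0ℚ + ι (suc r) * (a r 0 * 1ℚ)) ∎
  where
  R = ι⁻¹ (suc r)
  rearrange : ∀ x y → 1ℚ * (x * y) ≡ x * (0ℚ + y * (1ℚ * 1ℚ))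
  rearrange = solve-∀ ℚ-ring
pₑ-suc r (suc n) = begin
  a (suc r) (suc n) * (ι (suc n) * fact n)                   ≡⟨ cong (_* (ι (suc n) * fact n)) (a-suc r n) ⟩
  (a r (suc n) + a r n * R) * (ι (suc n) * fact n)           ≡⟨ expand (a r (suc n)) (a r n) R (ι (suc n)) (fact n) ⟩
  R * X + 1ℚ * Y                                             ≡⟨ cong (λ x → R * X + x * Y) (ι⁻¹-inverseˡ r) ⟨
  R * X + R * ι (suc r) * Y                                  ≡⟨ factor R X Y (ι (suc r)) ⟩
  R * (X + ι (suc r) * Y)                                    ∎
  where
  R = ι⁻¹ (suc r)
  X = ι (suc n) * (a r n * fact n)
  Y = a r (suc n) * (ι (suc n) * fact n)
  expand : ∀ a₁ a₀ r i f → (a₁ + a₀ * r) * (i * f) ≡ r * (i * (a₀ * f)) + 1ℚ * (a₁ * (i * f))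
  expand = solve-∀ ℚ-ring
  factor : ∀ r x y j → r * x + r * j * y ≡ r * (x + j * y)
  factor = solve-∀ ℚ-ring

[t+]·-t· : ∀ c (φ : ℕ → ℚ) n → ([t+ c ]· (t· φ)) n ≡ (t· ([t+ c ]· φ)) n
[t+]·-t· c φ zero    = trans (ℚₚ.+-identityˡ (c * 0ℚ)) (ℚₚ.*-zeroʳ c)
[t+]·-t· c φ (suc n) = distrib (ι (suc n)) c ((t· φ) n) (φ n)
  where
  distrib : ∀ i c x y → i * x + c * (i * y) ≡ i * (x + c * y)
  distrib = solve-∀ ℚ-ring

[t+]·-cong : ∀ c {φ ψ : ℕ → ℚ} → (∀ n → φ n ≡ ψ n) → ∀ n → ([t+ c ]· φ) n ≡ ([t+ c ]· ψ) n
[t+]·-cong c φ≗ψ n = cong₂ (λ x y → x + c * y) (t·-cong φ≗ψ n) (φ≗ψ n)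

[t+]·-*ˡ : ∀ c q (φ : ℕ → ℚ) n → ([t+ c ]· (λ m → q * φ m)) n ≡ q * ([t+ c ]· φ) n
[t+]·-*ˡ c q φ n = trans (cong (_+ c * (q * φ n)) (t·-*ˡ q φ n)) (distrib q ((t· φ) n) c (φ n))
  where
  distrib : ∀ q x c y → q * x + c * (q * y) ≡ q * (x + c * y)
  distrib = solve-∀ ℚ-ring

gₑ-suc : ∀ r n → gₑ (suc r) n ≡ ι⁻¹ (suc r) * ([t+ ι r ]· gₑ r) n
gₑ-suc zero    n = cong (ι⁻¹ 1 *_) (trans (t·-cong pₑ-zero n) (sym (trans (cong ((t· δ₀) n +_) (ℚₚ.*-zeroˡ (δ₀ n)))
                                                                         (ℚₚ.+-identityʳ ((t· δ₀) n)))))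
gₑ-suc (suc r) n = begin
  R′ * (t· pₑ (suc r)) n                               ≡⟨ cong (R′ *_) (t·-cong (pₑ-suc r) n) ⟩
  R′ * (t· (λ m → R * ([t+ ι (suc r) ]· pₑ r) m)) n    ≡⟨ cong (R′ *_) (t·-*ˡ R ([t+ ι (suc r) ]· pₑ r) n) ⟩
  R′ * (R * (t· ([t+ ι (suc r) ]· pₑ r)) n)            ≡⟨ cong (λ x → R′ * (R * x)) ([t+]·-t· (ι (suc r)) (pₑ r) n) ⟨
  R′ * (R * ([t+ ι (suc r) ]· (t· pₑ r)) n)            ≡⟨ cong (R′ *_) ([t+]·-*ˡ (ι (suc r)) R (t· pₑ r) n) ⟨
  R′ * ([t+ ι (suc r) ]· gₑ (suc r)) n                 ∎
  where
  R  = ι⁻¹ (suc r)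
  R′ = ι⁻¹ (suc (suc r))

shift-δ₀ : ∀ N k → shift (suc N) δ₀ k ≡ δ₀ k
shift-δ₀ N k = begin
  shift (suc N) δ₀ k                                              ≡⟨ sumTo-sucˡ N (λ n → δ₀ n * shiftKernel k n) ⟩
  1ℚ * shiftKernel k 0 + sumTo N (λ n → 0ℚ * shiftKernel k (suc n)) ≡⟨ cong₂ _+_ (ℚₚ.*-identityˡ (shiftKernel k 0))
                                                                              (sumTo-zero N (λ n _ → ℚₚ.*-zeroˡ (shiftKernel k (suc n)))) ⟩
  shiftKernel k 0 + 0ℚ                                            ≡⟨ ℚₚ.+-identityʳ (shiftKernel k 0) ⟩
  shiftKernel k 0                                                 ≡⟨ kernel-at-0 k ⟩
  δ₀ k                                                            ∎
  where
  kernel-at-0 : ∀ k → shiftKernel k 0 ≡ δ₀ k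
  kernel-at-0 zero    = refl
  kernel-at-0 (suc k) = refl

shift-gₑ : ∀ r N → r < N → ∀ k → shift (suc N) (gₑ r) k ≡ pₑ r k
shift-gₑ zero    N _   k = trans (shift-δ₀ N k) (sym (pₑ-zero k))
shift-gₑ (suc r) N r<N k = begin
  shift (suc N) (gₑ (suc r)) k                           ≡⟨ shift-cong (suc N) (gₑ-suc r) k ⟩
  shift (suc N) (λ n → R * ([t+ ι r ]· gₑ r) n) k        ≡⟨ shift-*ˡ (suc N) R ([t+ ι r ]· gₑ r) k ⟩
  R * shift (suc N) ([t+ ι r ]· gₑ r) k                  ≡⟨ cong (R *_) (shift-[t+] N (gₑ r) (ι r) (gₑ-vanishes r N r′<N) k) ⟩
  R * ([t+ ι r + 1ℚ ]· shift (suc N) (gₑ r)) k           ≡⟨ cong (R *_) ([t+]·-cong (ι r + 1ℚ) (shift-gₑ r N r′<N) k) ⟩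
  R * ([t+ ι r + 1ℚ ]· pₑ r) k                           ≡⟨ cong (λ c → R * ([t+ c ]· pₑ r) k) (trans (ℚₚ.+-comm (ι r) 1ℚ) (sym (ι-suc r))) ⟩
  R * ([t+ ι (suc r) ]· pₑ r) k                          ≡⟨ pₑ-suc r k ⟨
  pₑ (suc r) k                                           ∎
  where
  R = ι⁻¹ (suc r)
  r′<N = ℕₚ.<-trans (ℕₚ.n<1+n r) r<N

umbral-pₑ : ∀ N r → umbral N (pₑ r) ≡ sumTo N (λ n → a r n * B n)
umbral-pₑ N r = sumTo-cong N (λ n _ → ℚₚ.*-assoc (a r n) (fact n) (β n))

umbral-pₑ-suc : ∀ N r → umbral (suc N) (pₑ (suc r)) ≡ umbral (suc N) (pₑ r) + ι⁻¹ (suc r) * sumTo N (λ n → a r n * B (suc n))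
umbral-pₑ-suc N r = begin
  umbral (suc N) (pₑ (suc r))
    ≡⟨ trans (umbral-pₑ (suc N) (suc r)) (sumTo-sucˡ N (λ n → a (suc r) n * B n)) ⟩
  a (suc r) 0 * B 0 + sumTo N (λ n → a (suc r) (suc n) * B (suc n))
    ≡⟨ cong₂ _+_ (cong (_* B 0) (trans (a-0≡1 (suc r)) (sym (a-0≡1 r))))
                 (sumTo-cong N (λ n _ → trans (cong (_* B (suc n)) (a-suc r n)) (expand (a r (suc n)) (a r n) R (B (suc n))))) ⟩
  a r 0 * B 0 + sumTo N (λ n → a r (suc n) * B (suc n) + R * (a r n * B (suc n)))
    ≡⟨ cong (a r 0 * B 0 +_) (trans (sumTo-+ N _ _) (cong (sumTo N (λ n → a r (suc n) * B (suc n)) +_) (sumTo-*ˡ N R _))) ⟩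
  a r 0 * B 0 + (sumTo N (λ n → a r (suc n) * B (suc n)) + R * Y)
    ≡⟨ ℚₚ.+-assoc (a r 0 * B 0) _ (R * Y) ⟨
  a r 0 * B 0 + sumTo N (λ n → a r (suc n) * B (suc n)) + R * Y
    ≡⟨ cong (_+ R * Y) (trans (sym (sumTo-sucˡ N (λ n → a r n * B n))) (sym (umbral-pₑ (suc N) r))) ⟩
  umbral (suc N) (pₑ r) + R * Y ∎
  where
  R = ι⁻¹ (suc r)
  Y = sumTo N (λ n → a r n * B (suc n))
  expand : ∀ x y r b → (x + y * r) * b ≡ x * b + r * (y * b)
  expand = solve-∀ ℚ-ring

umbral-gₑ-suc : ∀ N r → umbral (suc N) (gₑ (suc r)) ≡ ι⁻¹ (suc r) * sumTo N (λ n → a r n * B (suc n))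
umbral-gₑ-suc N r = begin
  umbral (suc N) (gₑ (suc r))
    ≡⟨ sumTo-sucˡ N (λ n → gₑ (suc r) n * β n) ⟩
  R * 0ℚ * β 0 + sumTo N (λ n → R * (ι (suc n) * (a r n * fact n)) * β (suc n))
    ≡⟨ cong₂ _+_ (vanish R (β 0)) (sumTo-cong N (λ n _ → rearrange R (ι (suc n)) (a r n) (fact n) (β (suc n)))) ⟩
  0ℚ + sumTo N (λ n → R * (a r n * B (suc n)))
    ≡⟨ trans (ℚₚ.+-identityˡ _) (sumTo-*ˡ N R (λ n → a r n * B (suc n))) ⟩
  R * sumTo N (λ n → a r n * B (suc n)) ∎
  where
  R = ι⁻¹ (suc r)
  vanish : ∀ r b → r * 0ℚ * b ≡ 0ℚ
  vanish = solve-∀ ℚ-ring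
  rearrange : ∀ r i a f b → r * (i * (a * f)) * b ≡ r * (a * (i * f * b))
  rearrange = solve-∀ ℚ-ring

gₑ-suc-1 : ∀ r → gₑ (suc r) 1 ≡ ι⁻¹ (suc r)
gₑ-suc-1 r = trans (cong (λ x → ι⁻¹ (suc r) * (1ℚ * (x * 1ℚ))) (a-0≡1 r)) (ℚₚ.*-identityʳ (ι⁻¹ (suc r)))

-- Evaluate p_{r+1}(-t) = g_{r+1}(t + 1) umbrally in two ways: via
-- p_{r+1}(-t) = (1 + t/(r+1)) p_r(-t), and via f(B + 1) = f(B) + f′(0).
sumTo-a*B : ∀ r → sumTo (suc r) (λ j → a r j * B j) ≡ ι⁻¹ (suc r)
sumTo-a*B r = begin
  sumTo (suc r) (λ j → a r j * B j) ≡⟨ sumTo-extend (suc r) N (λ j → a r j * B j) (ℕₚ.m≤n+m (suc r) 2) beyond ⟨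
  sumTo N (λ j → a r j * B j)       ≡⟨ umbral-pₑ N r ⟨
  umbral N (pₑ r)                   ≡⟨ ∙-cancelʳ (R * Y) (umbral N (pₑ r)) R two-ways ⟩
  R                                 ∎
  where
  N = suc (suc (suc r))
  R = ι⁻¹ (suc r)
  Y = sumTo (suc (suc r)) (λ n → a r n * B (suc n))
  beyond : ∀ j → suc r ≤ j → a r j * B j ≡ 0ℚ
  beyond j r<j = trans (cong (_* B j) (a-vanishes r j r<j)) (ℚₚ.*-zeroˡ (B j))
  two-ways : umbral N (pₑ r) + R * Y ≡ R + R * Y
  two-ways = begin
    umbral N (pₑ r) + R * Y                           ≡⟨ umbral-pₑ-suc (suc (suc r)) r ⟨
    umbral N (pₑ (suc r))                             ≡⟨ sumTo-cong N (λ k _ → cong (_* β k) (shift-gₑ (suc r) (suc (suc r)) ℕₚ.≤-refl k)) ⟨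
    umbral N (shift N (gₑ (suc r)))                   ≡⟨ umbral-shift N (gₑ (suc r)) (s≤s (s≤s z≤n)) ⟩
    umbral N (gₑ (suc r)) + gₑ (suc r) 1              ≡⟨ cong₂ _+_ (umbral-gₑ-suc (suc (suc r)) r) (gₑ-suc-1 r) ⟩
    R * Y + R                                         ≡⟨ ℚₚ.+-comm (R * Y) R ⟩
    R + R * Y                                         ∎

L-entry : ∀ m (i k : Fin (suc m)) → L m i k ≡ guard≤ (toℕ k) (toℕ i) (ι⁻¹ (suc (toℕ i ∸ toℕ k)))
L-entry m i k with toℕ k ℕ.≤? toℕ i
... | yes k≤i = trans (sym (ι⁻¹-suc≡1/suc (toℕ i ∸ toℕ k))) (sym (guard≤-yes _ k≤i))
... | no  k≰i = sym (guard≤-no _ (ℕₚ.≰⇒> k≰i))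

U-entry : ∀ m (i k : Fin (suc m)) → U m i k ≡ guard≤ (suc (toℕ i)) (toℕ k) (ι⁻¹ (toℕ k))
U-entry m i k with toℕ i ℕ.<? toℕ k
... | yes i<k = sym (guard≤-yes (ι⁻¹ (toℕ k)) i<k)
... | no  i≮k = sym (guard≤-no (ι⁻¹ (toℕ k)) (s≤s (ℕₚ.≮⇒≥ i≮k)))

module _ (s : ℚ) where

  den : ℕ → ℚ
  den j = s + ι j - 1ℚ

  x : ℚ
  x = 1ℚ - s

  b : ℕ → ℚ
  b i = B (suc i) * inv (den (suc i))

  u : ℕ → ℚ
  u zero    = 1ℚ
  u (suc k) = - sumTo (suc k) (λ i → a k i * b i)

  F-suc : ∀ r → F (suc r) s ≡ F r s - u (suc r) * ι⁻¹ (suc r)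
  F-suc r = begin
    sumTo (suc (suc r)) (λ j → a (suc r) j * B j * inv (den j))
      ≡⟨ sumTo-sucˡ (suc r) (λ j → a (suc r) j * B j * inv (den j)) ⟩
    a (suc r) 0 * B 0 * inv (den 0) + sumTo (suc r) (λ i → a (suc r) (suc i) * B (suc i) * inv (den (suc i)))
      ≡⟨ cong₂ _+_ (cong (λ y → y * B 0 * inv (den 0)) (trans (a-0≡1 (suc r)) (sym (a-0≡1 r))))
                   (sumTo-cong (suc r) (λ i _ → trans (cong (λ y → y * B (suc i) * inv (den (suc i))) (a-suc r i))
                                                      (expand (a r (suc i)) (a r i) R (B (suc i)) (inv (den (suc i)))))) ⟩
    a r 0 * B 0 * inv (den 0) + sumTo (suc r) (λ i → t (suc i) + R * (a r i * b i))
      ≡⟨ cong (a r 0 * B 0 * inv (den 0) +_) (trans (sumTo-+ (suc r) _ _) (cong (sumTo (suc r) (t ∘ suc) +_) (sumTo-*ˡ (suc r) R _))) ⟩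
    t 0 + (sumTo (suc r) (t ∘ suc) + R * Σ)
      ≡⟨ ℚₚ.+-assoc (t 0) (sumTo (suc r) (t ∘ suc)) (R * Σ) ⟨
    t 0 + sumTo (suc r) (t ∘ suc) + R * Σ
      ≡⟨ cong (_+ R * Σ) (sumTo-sucˡ (suc r) t) ⟨
    F r s + t (suc r) + R * Σ
      ≡⟨ cong (λ y → F r s + y * B (suc r) * inv (den (suc r)) + R * Σ) (a-vanishes r (suc r) (ℕₚ.n<1+n r)) ⟩
    F r s + 0ℚ * B (suc r) * inv (den (suc r)) + R * Σ
      ≡⟨ simplify (F r s) (B (suc r)) (inv (den (suc r))) R Σ ⟩
    F r s - u (suc r) * R ∎
    where
    R = ι⁻¹ (suc r)
    t : ℕ → ℚ
    t j = a r j * B j * inv (den j)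
    Σ = sumTo (suc r) (λ i → a r i * b i)
    expand : ∀ a₁ a₀ r b d → (a₁ + a₀ * r) * b * d ≡ a₁ * b * d + r * (a₀ * (b * d))
    expand = solve-∀ ℚ-ring
    simplify : ∀ f b d r y → f + 0ℚ * b * d + r * y ≡ f - (- y) * r
    simplify = solve-∀ ℚ-ring

  -- The k = 0 term vanishes because inv 0 = 0.
  sumTo-u*ι⁻¹ : ∀ r → sumTo (suc r) (λ k → u k * ι⁻¹ k) ≡ F 0 s - F r s
  sumTo-u*ι⁻¹ zero    = sym (ℚₚ.+-inverseʳ (F 0 s))
  sumTo-u*ι⁻¹ (suc r) = begin
    sumTo (suc r) (λ k → u k * ι⁻¹ k) + u (suc r) * ι⁻¹ (suc r) ≡⟨ cong (_+ u (suc r) * ι⁻¹ (suc r)) (sumTo-u*ι⁻¹ r) ⟩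
    F 0 s - F r s + u (suc r) * ι⁻¹ (suc r)                    ≡⟨ regroup (F 0 s) (F r s) (u (suc r) * ι⁻¹ (suc r)) ⟩
    F 0 s - (F r s - u (suc r) * ι⁻¹ (suc r))                  ≡⟨ cong (λ y → F 0 s - y) (F-suc r) ⟨
    F 0 s - F (suc r) s                                       ∎
    where
    regroup : ∀ f g y → f - g + y ≡ f - (g - y)
    regroup = solve-∀ ℚ-ring

  T : ℕ → ℚ
  T r = sumTo r (λ i → ι (suc i) * a r (suc i) * b i)

  x*F : ∀ r → (∀ j → j ≤ r → den j ≢ 0ℚ) → x * F r s ≡ T r - ι⁻¹ (suc r)
  x*F r den≢0 = begin
    x * F r s
      ≡⟨ sumTo-*ˡ (suc r) x (λ j → a r j * B j * inv (den j)) ⟨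
    sumTo (suc r) (λ j → x * (a r j * B j * inv (den j)))
      ≡⟨ sumTo-cong (suc r) (λ j j≤r → x*term j (den≢0 j (ℕₚ.≤-pred j≤r))) ⟩
    sumTo (suc r) (λ j → ι j * a r j * B j * inv (den j) - a r j * B j)
      ≡⟨ sumTo-- (suc r) (λ j → ι j * a r j * B j * inv (den j)) (λ j → a r j * B j) ⟩
    sumTo (suc r) (λ j → ι j * a r j * B j * inv (den j)) - sumTo (suc r) (λ j → a r j * B j)
      ≡⟨ cong₂ _-_ (sumTo-sucˡ r (λ j → ι j * a r j * B j * inv (den j))) (sumTo-a*B r) ⟩
    0ℚ * a r 0 * B 0 * inv (den 0) + sumTo r (λ i → ι (suc i) * a r (suc i) * B (suc i) * inv (den (suc i))) - ι⁻¹ (suc r)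
      ≡⟨ cong₂ (λ y z → y + z - ι⁻¹ (suc r)) (vanish (a r 0) (B 0) (inv (den 0)))
               (sumTo-cong r (λ i _ → ℚₚ.*-assoc (ι (suc i) * a r (suc i)) (B (suc i)) (inv (den (suc i))))) ⟩
    0ℚ + T r - ι⁻¹ (suc r)
      ≡⟨ cong (_- ι⁻¹ (suc r)) (ℚₚ.+-identityˡ (T r)) ⟩
    T r - ι⁻¹ (suc r) ∎
    where
    vanish : ∀ y z w → 0ℚ * y * z * w ≡ 0ℚ
    vanish = solve-∀ ℚ-ring
    x*term : ∀ j → den j ≢ 0ℚ → x * (a r j * B j * inv (den j)) ≡ ι j * a r j * B j * inv (den j) - a r j * B j
    x*term j den≢0 = begin
      x * (y * inv (den j))                                   ≡⟨ split s (ι j) y (inv (den j)) ⟩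
      ι j * y * inv (den j) - y + y * (1ℚ - den j * inv (den j)) ≡⟨ cong (λ z → ι j * y * inv (den j) - y + y * (1ℚ - z)) (inv-inverseʳ den≢0) ⟩
      ι j * y * inv (den j) - y + y * (1ℚ - 1ℚ)                ≡⟨ simplify (ι j * y * inv (den j) - y) y ⟩
      ι j * y * inv (den j) - y                                ≡⟨ cong (λ z → z * inv (den j) - y) (ℚₚ.*-assoc (ι j) (a r j) (B j)) ⟨
      ι j * a r j * B j * inv (den j) - a r j * B j            ∎
      where
      y = a r j * B j
      split : ∀ s i y d → (1ℚ - s) * (y * d) ≡ i * y * d - y + y * (1ℚ - (s + i - 1ℚ) * d)
      split = solve-∀ ℚ-ring
      simplify : ∀ v y → v + y * (1ℚ - 1ℚ) ≡ v
      simplify = solve-∀ ℚ-ring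

  sumTo-u-suc*ι⁻¹ : ∀ r → sumTo r (λ k → u (suc k) * ι⁻¹ (r ∸ k)) ≡ - T r
  sumTo-u-suc*ι⁻¹ r = begin
    sumTo r (λ k → u (suc k) * c k)
      ≡⟨ sumTo-cong r (λ k k<r → trans (cong (λ p → - p * c k) (truncate k k<r)) (sym (ℚₚ.neg-distribˡ-* (S k) (c k)))) ⟩
    sumTo r (λ k → - (S k * c k))
      ≡⟨ sumTo-neg r (λ k → S k * c k) ⟩
    - sumTo r (λ k → S k * c k)
      ≡⟨ cong -_ (sumTo-cong r (λ k _ → sym (sumTo-*ʳ r (c k) (λ i → a k i * b i)))) ⟩
    - sumTo r (λ k → sumTo r (λ i → a k i * b i * c k))
      ≡⟨ cong -_ (sumTo-comm r r (λ k i → a k i * b i * c k)) ⟩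
    - sumTo r (λ i → sumTo r (λ k → a k i * b i * c k))
      ≡⟨ cong -_ (sumTo-cong r (λ i _ → column-sum i)) ⟩
    - T r ∎
    where
    c : ℕ → ℚ
    c k = ι⁻¹ (r ∸ k)
    S : ℕ → ℚ
    S k = sumTo r (λ i → a k i * b i)
    truncate : ∀ k → k < r → sumTo (suc k) (λ i → a k i * b i) ≡ S k
    truncate k k<r = sym (sumTo-extend (suc k) r (λ i → a k i * b i) k<r
                                       (λ i k<i → trans (cong (_* b i) (a-vanishes k i k<i)) (ℚₚ.*-zeroˡ (b i))))
    swap : ∀ p q c → p * q * c ≡ p * c * q
    swap = solve-∀ ℚ-ring
    column-sum : ∀ i → sumTo r (λ k → a k i * b i * c k) ≡ ι (suc i) * a r (suc i) * b i
    column-sum i = begin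
      sumTo r (λ k → a k i * b i * c k) ≡⟨ sumTo-cong r (λ k _ → swap (a k i) (b i) (c k)) ⟩
      sumTo r (λ k → a k i * c k * b i) ≡⟨ sumTo-*ʳ r (b i) (λ k → a k i * c k) ⟩
      sumTo r (λ k → a k i * c k) * b i ≡⟨ cong (_* b i) (a-convolution r i) ⟩
      ι (suc i) * a r (suc i) * b i     ∎

  sumTo-u*ι⁻¹-reversed : ∀ r → (∀ j → j ≤ r → den j ≢ 0ℚ) → sumTo (suc r) (λ k → u k * ι⁻¹ (suc (r ∸ k))) ≡ - (x * F r s)
  sumTo-u*ι⁻¹-reversed r den≢0 = begin
    sumTo (suc r) (λ k → u k * ι⁻¹ (suc (r ∸ k)))
      ≡⟨ sumTo-sucˡ r (λ k → u k * ι⁻¹ (suc (r ∸ k))) ⟩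
    1ℚ * ι⁻¹ (suc r) + sumTo r (λ k → u (suc k) * ι⁻¹ (suc (r ∸ suc k)))
      ≡⟨ cong₂ _+_ (ℚₚ.*-identityˡ (ι⁻¹ (suc r))) (sumTo-cong r (λ k k<r → cong (λ n → u (suc k) * ι⁻¹ n) (sym (ℕₚ.+-∸-assoc 1 k<r)))) ⟩
    ι⁻¹ (suc r) + sumTo r (λ k → u (suc k) * ι⁻¹ (r ∸ k))
      ≡⟨ cong (ι⁻¹ (suc r) +_) (sumTo-u-suc*ι⁻¹ r) ⟩
    ι⁻¹ (suc r) - T r
      ≡⟨ flip-difference (ι⁻¹ (suc r)) (T r) ⟩
    - (T r - ι⁻¹ (suc r))
      ≡⟨ cong -_ (x*F r den≢0) ⟨
    - (x * F r s) ∎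
    where
    flip-difference : ∀ p q → p - q ≡ - (q - p)
    flip-difference = solve-∀ ℚ-ring

  W : ℕ → ℕ → ℚ
  W r k = guard≤ k r (ι⁻¹ (suc (r ∸ k))) + x * guard≤ (suc r) k (ι⁻¹ k)

  W-row*u : ∀ m r → r ≤ m → (∀ j → j ≤ m → den j ≢ 0ℚ) → sumTo (suc m) (λ k → W r k * u k) ≡ den 0 * F m s
  W-row*u m r r≤m den≢0 = begin
    sumTo (suc m) (λ k → W r k * u k)
      ≡⟨ sumTo-cong (suc m) (λ k _ → term k) ⟩
    sumTo (suc m) (λ k → guard≤ k r (u k * ι⁻¹ (suc (r ∸ k))) + x * (u k * ι⁻¹ k - guard≤ k r (u k * ι⁻¹ k)))
      ≡⟨ trans (sumTo-+ (suc m) _ _) (cong (sumTo (suc m) (λ k → guard≤ k r (u k * ι⁻¹ (suc (r ∸ k)))) +_)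
                                          (trans (sumTo-*ˡ (suc m) x _) (cong (x *_) (sumTo-- (suc m) _ _)))) ⟩
    sumTo (suc m) (λ k → guard≤ k r (u k * ι⁻¹ (suc (r ∸ k))))
      + x * (sumTo (suc m) (λ k → u k * ι⁻¹ k) - sumTo (suc m) (λ k → guard≤ k r (u k * ι⁻¹ k)))
      ≡⟨ cong₂ (λ y z → y + x * (sumTo (suc m) (λ k → u k * ι⁻¹ k) - z))
               (sumTo-guard≤ (suc m) r (λ k → u k * ι⁻¹ (suc (r ∸ k))) (s≤s r≤m))
               (sumTo-guard≤ (suc m) r (λ k → u k * ι⁻¹ k) (s≤s r≤m)) ⟩
    sumTo (suc r) (λ k → u k * ι⁻¹ (suc (r ∸ k))) + x * (sumTo (suc m) (λ k → u k * ι⁻¹ k) - sumTo (suc r) (λ k → u k * ι⁻¹ k))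
      ≡⟨ cong₂ (λ y z → y + x * z) (sumTo-u*ι⁻¹-reversed r (λ j j≤r → den≢0 j (ℕₚ.≤-trans j≤r r≤m)))
                                   (cong₂ _-_ (sumTo-u*ι⁻¹ m) (sumTo-u*ι⁻¹ r)) ⟩
    - (x * F r s) + x * ((F 0 s - F m s) - (F 0 s - F r s))
      ≡⟨ collapse s (F 0 s) (F m s) (F r s) ⟩
    (s + 0ℚ - 1ℚ) * F m s ∎
    where
    collapse : ∀ s f₀ fₘ fᵣ → - ((1ℚ - s) * fᵣ) + (1ℚ - s) * ((f₀ - fₘ) - (f₀ - fᵣ)) ≡ (s + 0ℚ - 1ℚ) * fₘ
    collapse = solve-∀ ℚ-ring
    distrib : ∀ g x q c u → (g + x * (q - c)) * u ≡ u * g + x * (u * q - u * c)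
    distrib = solve-∀ ℚ-ring
    term : ∀ k → W r k * u k ≡ guard≤ k r (u k * ι⁻¹ (suc (r ∸ k))) + x * (u k * ι⁻¹ k - guard≤ k r (u k * ι⁻¹ k))
    term k = begin
      W r k * u k
        ≡⟨ cong (λ g → (guard≤ k r (ι⁻¹ (suc (r ∸ k))) + x * g) * u k) (guard≤-complement r k (ι⁻¹ k)) ⟩
      (guard≤ k r (ι⁻¹ (suc (r ∸ k))) + x * (ι⁻¹ k - guard≤ k r (ι⁻¹ k))) * u k
        ≡⟨ distrib (guard≤ k r (ι⁻¹ (suc (r ∸ k)))) x (ι⁻¹ k) (guard≤ k r (ι⁻¹ k)) (u k) ⟩
      u k * guard≤ k r (ι⁻¹ (suc (r ∸ k))) + x * (u k * ι⁻¹ k - u k * guard≤ k r (ι⁻¹ k))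
        ≡⟨ cong₂ (λ y z → y + x * (u k * ι⁻¹ k - z)) (guard≤-*ˡ k r (u k) _) (guard≤-*ˡ k r (u k) (ι⁻¹ k)) ⟨
      guard≤ k r (u k * ι⁻¹ (suc (r ∸ k))) + x * (u k * ι⁻¹ k - guard≤ k r (u k * ι⁻¹ k)) ∎

  M-entry : ∀ m (i k : Fin (suc m)) → L m i k + (1ℚ - s) * U m i k ≡ W (toℕ i) (toℕ k)
  M-entry m i k = cong₂ (λ l y → l + x * y) (L-entry m i k) (U-entry m i k)

  pivot : ℕ → ℚ
  pivot r = 1ℚ - x * ι⁻¹ (suc r)

  W-diagonal : ∀ r → W (suc r) (suc r) - W r (suc r) ≡ pivot r
  W-diagonal r = trans (cong₂ _-_ on-diagonal above-diagonal) (simplify x (ι⁻¹ (suc r)))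
    where
    on-diagonal : W (suc r) (suc r) ≡ 1ℚ + x * 0ℚ
    on-diagonal = cong₂ (λ y z → y + x * z)
                        (trans (guard≤-yes (ι⁻¹ (suc (r ∸ r))) (ℕₚ.≤-refl {r})) (cong (ι⁻¹ ∘ suc) (ℕₚ.n∸n≡0 r)))
                        (guard≤-no (ι⁻¹ (suc r)) (ℕₚ.n<1+n r))
    above-diagonal : W r (suc r) ≡ 0ℚ + x * ι⁻¹ (suc r)
    above-diagonal = cong₂ (λ y z → y + x * z) (guard≤-no (ι⁻¹ (suc (r ∸ suc r))) (ℕₚ.n<1+n r)) (guard≤-yes (ι⁻¹ (suc r)) (ℕₚ.≤-refl {r}))
    simplify : ∀ x c → (1ℚ + x * 0ℚ) - (0ℚ + x * c) ≡ 1ℚ - x * c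
    simplify = solve-∀ ℚ-ring

  W-upper : ∀ r k → suc r < k → W (suc r) k - W r k ≡ 0ℚ
  W-upper r k r<k = begin
    W (suc r) k - W r k
      ≡⟨ cong₂ (λ y z → (y + x * guard≤ (suc (suc r)) k (ι⁻¹ k)) - (z + x * guard≤ (suc r) k (ι⁻¹ k)))
               (guard≤-no _ r<k) (guard≤-no _ (ℕₚ.<-trans (ℕₚ.n<1+n r) r<k)) ⟩
    (0ℚ + x * guard≤ (suc (suc r)) k (ι⁻¹ k)) - (0ℚ + x * guard≤ (suc r) k (ι⁻¹ k))
      ≡⟨ cong₂ (λ y z → (0ℚ + x * y) - (0ℚ + x * z)) (guard≤-yes (ι⁻¹ k) r<k) (guard≤-yes (ι⁻¹ k) (ℕₚ.<⇒≤ r<k)) ⟩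
    (0ℚ + x * ι⁻¹ k) - (0ℚ + x * ι⁻¹ k)
      ≡⟨ cancel (x * ι⁻¹ k) ⟩
    0ℚ ∎
    where
    cancel : ∀ y → (0ℚ + y) - (0ℚ + y) ≡ 0ℚ
    cancel = solve-∀ ℚ-ring

  pivot*ι : ∀ r → pivot r * ι (suc r) ≡ den (suc r)
  pivot*ι r = begin
    (1ℚ - x * ι⁻¹ (suc r)) * ι (suc r)                           ≡⟨ expand s (ι⁻¹ (suc r)) (ι (suc r)) ⟩
    s + ι (suc r) - 1ℚ + (1ℚ - s) * (1ℚ - ι⁻¹ (suc r) * ι (suc r)) ≡⟨ cong (λ y → den (suc r) + x * (1ℚ - y)) (ι⁻¹-inverseˡ r) ⟩
    s + ι (suc r) - 1ℚ + (1ℚ - s) * (1ℚ - 1ℚ)                     ≡⟨ simplify (den (suc r)) s ⟩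
    den (suc r)                                                  ∎
    where
    expand : ∀ s c i → (1ℚ - (1ℚ - s) * c) * i ≡ s + i - 1ℚ + (1ℚ - s) * (1ℚ - c * i)
    expand = solve-∀ ℚ-ring
    simplify : ∀ d s → d + (1ℚ - s) * (1ℚ - 1ℚ) ≡ d
    simplify = solve-∀ ℚ-ring

  pivot≢0 : ∀ r → den (suc r) ≢ 0ℚ → pivot r ≢ 0ℚ
  pivot≢0 r den≢0 pivot≡0 = den≢0 (trans (sym (pivot*ι r)) (trans (cong (_* ι (suc r)) pivot≡0) (ℚₚ.*-zeroˡ (ι (suc r)))))

  fact*prodTo-pivot : ∀ n → fact n * prodTo n pivot ≡ prodTo n (den ∘ suc)
  fact*prodTo-pivot zero    = refl
  fact*prodTo-pivot (suc n) = begin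
    ι (suc n) * fact n * (prodTo n pivot * pivot n) ≡⟨ regroup (ι (suc n)) (fact n) (prodTo n pivot) (pivot n) ⟩
    fact n * prodTo n pivot * (pivot n * ι (suc n)) ≡⟨ cong₂ _*_ (fact*prodTo-pivot n) (pivot*ι n) ⟩
    prodTo n (den ∘ suc) * den (suc n)        ∎
    where
    regroup : ∀ i f p d → i * f * (p * d) ≡ f * p * (d * i)
    regroup = solve-∀ ℚ-ring

  ΔW-row*u : ∀ m r → r < m → (∀ j → j ≤ m → den j ≢ 0ℚ) → sumTo (suc m) (λ k → (W (suc r) k - W r k) * u k) ≡ 0ℚ
  ΔW-row*u m r r<m den≢0 = begin
    sumTo (suc m) (λ k → (W (suc r) k - W r k) * u k)
      ≡⟨ sumTo-cong (suc m) (λ k _ → distrib (W (suc r) k) (W r k) (u k)) ⟩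
    sumTo (suc m) (λ k → W (suc r) k * u k - W r k * u k)
      ≡⟨ sumTo-- (suc m) (λ k → W (suc r) k * u k) (λ k → W r k * u k) ⟩
    sumTo (suc m) (λ k → W (suc r) k * u k) - sumTo (suc m) (λ k → W r k * u k)
      ≡⟨ cong₂ _-_ (W-row*u m (suc r) r<m den≢0) (W-row*u m r (ℕₚ.<⇒≤ r<m) den≢0) ⟩
    den 0 * F m s - den 0 * F m s
      ≡⟨ ℚₚ.+-inverseʳ (den 0 * F m s) ⟩
    0ℚ ∎
    where
    distrib : ∀ p q u → (p - q) * u ≡ p * u - q * u
    distrib = solve-∀ ℚ-ring

  det-M : ∀ m → (∀ j → j ≤ m → den j ≢ 0ℚ) →
          det (suc m) (λ i k → L m i k + (1ℚ - s) * U m i k) ≡ prodTo m pivot * (den 0 * F m s)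
  det-M m den≢0 = begin
    det (suc m) M
      ≡⟨ det-Δ m M ⟨
    det (suc m) (Δ M)
      ≡⟨ det-byKernelVector m (Δ M) upper pivot diagonal (λ r r<m → pivot≢0 r (den≢0 (suc r) r<m)) (u ∘ toℕ) refl kernel ⟩
    prodTo m pivot * sumFin (suc m) (λ k → M fzero k * u (toℕ k))
      ≡⟨ cong (prodTo m pivot *_) (sumFin≡sumTo (suc m) _ (λ k → W 0 k * u k) (λ k → cong (_* u (toℕ k)) (M-entry m fzero k))) ⟩
    prodTo m pivot * sumTo (suc m) (λ k → W 0 k * u k)
      ≡⟨ cong (prodTo m pivot *_) (W-row*u m 0 z≤n den≢0) ⟩
    prodTo m pivot * (den 0 * F m s) ∎
    where
    M : Mat (suc m)
    M i k = L m i k + (1ℚ - s) * U m i k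
    ΔM-suc : ∀ i k → Δ M (fsuc i) k ≡ W (suc (toℕ i)) (toℕ k) - W (toℕ i) (toℕ k)
    ΔM-suc i k = cong₂ _-_ (M-entry m (fsuc i) k) (trans (M-entry m (inject₁ i) k) (cong (λ r → W r (toℕ k)) (Finₚ.toℕ-inject₁ i)))
    upper : ∀ i k → suc (toℕ i) < toℕ k → Δ M (fsuc i) k ≡ 0ℚ
    upper i k i<k = trans (ΔM-suc i k) (W-upper (toℕ i) (toℕ k) i<k)
    diagonal : ∀ i → Δ M (fsuc i) (fsuc i) ≡ pivot (toℕ i)
    diagonal i = trans (ΔM-suc i (fsuc i)) (W-diagonal (toℕ i))
    kernel : ∀ i → sumFin (suc m) (λ k → Δ M (fsuc i) k * u (toℕ k)) ≡ 0ℚ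
    kernel i = trans (sumFin≡sumTo (suc m) _ (λ k → (W (suc (toℕ i)) k - W (toℕ i) k) * u k) (λ k → cong (_* u (toℕ k)) (ΔM-suc i k)))
                     (ΔW-row*u m (toℕ i) (Finₚ.toℕ<n i) den≢0)

mainTheorem10 : (m : ℕ) (s : ℚ) →
    (∀ j → j ≤ m → s + ι j - 1ℚ ≢ 0ℚ) →
    F m s ≡ fact m * det (suc m) (λ i k → L m i k + (1ℚ - s) * U m i k)
              * inv (prodTo (suc m) (λ j → s + ι j - 1ℚ))
mainTheorem10 m s den≢0 = sym (begin
  fact m * det (suc m) (λ i k → L m i k + (1ℚ - s) * U m i k) * inv (prodTo (suc m) (den s))
    ≡⟨ cong₂ (λ d p → fact m * d * inv p) (det-M s m den≢0) (prodTo-sucˡ m (den s)) ⟩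
  fact m * (prodTo m (pivot s) * (den s 0 * F m s)) * inv (den s 0 * Q)
    ≡⟨ cong (_* inv (den s 0 * Q)) (trans (sym (ℚₚ.*-assoc (fact m) _ _)) (cong (_* (den s 0 * F m s)) (fact*prodTo-pivot s m))) ⟩
  Q * (den s 0 * F m s) * inv (den s 0 * Q)
    ≡⟨ *-inv-cancel (F m s) (den≢0 0 z≤n) (prodTo≢0 m (den s ∘ suc) (λ j j<m → den≢0 (suc j) j<m)) ⟩
  F m s ∎)
  where
  Q = prodTo m (den s ∘ suc)
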